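{- Let $g \geq 2$ be an integer and let $q > 0$ and $r$ be integers. Let $\mathcal{S}_{q,r}$ be the set of positive integers $n$ such that: (S1) $s_g(n) \equiv r \pmod q$; and (S2) for all positive integers $m$ such that $[m]_g$ is a substring of $[n]_g$ and $\ell_g(m) \geq 36 \log \ell_g(n)$, we have $s_g(m) > \tfrac{g-1}{3}\,\ell_g(m)$. Then $\mathcal{S}_{q,r}$ has positive lower asymptotic density.
   Context: For a positive integer $n$, write uniquely $n = \sum_{i=1}^{\ell} d_i g^{i-1}$ with $d_1,\dots,d_\ell \in \{0,\dots,g-1\}$ and $d_\ell \neq 0$; $[n]_g$ denotes the string $d_1, \dots, d_\ell$, $s_g(n) := \sum_{i=1}^\ell d_i$, and $\ell_g(n) := \ell$. A substring means a contiguous block of consecutive entries of the string. $\log$ is the natural logarithm. The lower asymptotic density of a set $\mathcal{A}$ of positive integers is $\liminf_{x\to+\infty} |\mathcal{A}\cap[1,x]|/x$. -}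

module Defs where

open import Data.Nat using (ℕ; zero; suc; _+_; _*_; _^_; _≤_; _<_; _/_; _%_)
open import Data.Nat using (_!)
open import Data.Integer as ℤ using (ℤ; +_; _-_)
open import Data.Integer.Divisibility as ℤd using ()
open import Data.List using (List; []; _∷_; _++_; length)
open import Data.Nat.ListAction using (sum)
open import Data.Product using (Σ; _×_; ∃; ∃-syntax)
open import Data.Nat using (_∸_)
open import Relation.Binary.PropositionalEquality using (_≡_)
open import Data.List.Relation.Unary.All using (All)
open import Data.List.Relation.Unary.Unique.Propositional using (Unique)

-- Base-g digits, least significant first: [n]_g = d₁ … d_ℓ with n = Σ dᵢ g^(i-1).
-- Defined for g = suc (suc b) (i.e. g ≥ 2); junk value [] for g < 2
-- (the theorem assumes g ≥ 2).  The fuel n suffices since n / g < n.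
digitsAux : ℕ → ℕ → ℕ → List ℕ
digitsAux b zero    n       = []
digitsAux b (suc f) zero    = []
digitsAux b (suc f) (suc n) =
  (suc n % suc (suc b)) ∷ digitsAux b f (suc n / suc (suc b))

digits : ℕ → ℕ → List ℕ
digits (suc (suc b)) n = digitsAux b n n
digits _             n = []

s : ℕ → ℕ → ℕ
s g n = sum (digits g n)

len : ℕ → ℕ → ℕ
len g n = length (digits g n)

IsSubstring : List ℕ → List ℕ → Set
IsSubstring u w = ∃[ xs ] ∃[ ys ] (w ≡ xs ++ u ++ ys)

-- expNum ℓ K = K! · Σ_{k=0}^{K} ℓ^k / k!  (a natural number), i.e. K! times
-- the K-th partial sum of the exponential series for e^ℓ.
expNum : ℕ → ℕ → ℕ
expNum ℓ zero    = 1
expNum ℓ (suc K) = suc K * expNum ℓ K + ℓ ^ suc K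

-- LogLe L ℓ  encodes the real inequality  36 · log L ≤ ℓ  (natural log),
-- i.e.  L^36 ≤ e^ℓ, via: some partial sum of Σ ℓ^k/k! is ≥ L^36.
-- (Exact: partial sums increase to e^ℓ, and e^ℓ is irrational for ℓ ≥ 1;
--  for ℓ = 0 both sides say L^36 ≤ 1.)
LogLe : ℕ → ℕ → Set
LogLe L ℓ = ∃[ K ] (L ^ 36 * K ! ≤ expNum ℓ K)

InS : (g q : ℕ) (r : ℤ) (n : ℕ) → Set
InS g q r n =
  1 ≤ n
  × (+ q) ℤd.∣ ((+ s g n) - r)
  × ((m : ℕ) → 1 ≤ m → IsSubstring (digits g m) (digits g n)
       → LogLe (len g n) (len g m)
       → (g ∸ 1) * len g m < 3 * s g m)

-- Positive lower asymptotic density of a predicate A on ℕ: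
-- ∃ c = 1/(k+1) > 0 and X such that for all x ≥ X, A ∩ [1,x] has at least
-- c·x elements (witnessed by a duplicate-free list of such elements).
PositiveLowerDensity : (ℕ → Set) → Set
PositiveLowerDensity A =
  ∃[ k ] ∃[ X ] ((x : ℕ) → X ≤ x →
    ∃[ xs ] (Unique xs × All (λ n → 1 ≤ n × n ≤ x × A n) xs
             × x ≤ suc k * length xs))

-- Put a block u of N base-g digits between a prefix of length 2q and a final digit g − 1.
-- The prefix alternates digits 0 or 1 with g − 1, so each of its suffixes has digit sum at
-- least (g − 1)/3 per digit, and its number of 1s makes the total digit sum r mod q.  Call u
-- bad if some window of u whose length passes the 36 log threshold has digit sum at most
-- (g − 1)/3 per digit.  By a Chernoff bound a window of length ℓ is that light for at most a
-- (24/25)^ℓ fraction of the blocks; as 36 log(24/25) < −1, summing over the at most N + 1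
-- starting points and all long lengths shows that at most half of the g^N blocks are bad once
-- N is large.  Each good block gives an element of S_{q,r} with N + 2q + 1 digits, since a
-- long window of the number is a long window of u flanked by pieces of the padding, which
-- keep it heavy.  Hence S_{q,r} ∩ [1, x] has at least g^N / 2 ≥ x / (2 g^(2q+2)) elements.

module Submission where

open import Data.Bool using (Bool; true; false; _∨_; _∧_; not; T; if_then_else_)
open import Data.Bool.Properties using (T-∨; T-∧)
open import Data.Empty using (⊥-elim)
open import Data.Integer as ℤ using (ℤ)
open import Data.Integer.DivMod using (_%ℕ_; _/ℕ_; a≡a%ℕn+[a/ℕn]*n; n%ℕd<d)
import Data.Integer.Divisibility as ℤ∣
open import Data.Integer.Divisibility.Signed using (divides; ∣⇒∣ᵤ)
open import Data.Integer.Properties using (pos-+; pos-*)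
import Data.Integer.Tactic.RingSolver as ℤ-Solver
open import Data.List using (List; []; _∷_; _++_; length; take; replicate)
open import Data.List.Properties using (length-++; length-replicate; ∷-injective; ++-assoc; ++-identityʳ; ++-cancelʳ)
open import Data.List.Relation.Unary.All as All using (All; []; _∷_)
open import Data.List.Relation.Unary.All.Properties using (++⁺; replicate⁺)
open import Data.List.Relation.Unary.AllPairs using ([]; _∷_)
open import Data.List.Relation.Unary.Unique.Propositional using (Unique)
open import Data.Nat
open import Data.Nat.DivMod
open import Data.Nat.Divisibility using (divides-refl)
open import Data.Nat.ListAction using (sum)
open import Data.Nat.ListAction.Properties using (sum-++)
open import Data.Nat.Properties
open import Algebra.Properties.CommutativeSemigroup *-commutativeSemigroup
  using (interchange; x∙yz≈y∙xz; x∙yz≈yx∙z; x∙yz≈xz∙y; xy∙z≈xz∙y; xy∙z≈zx∙y; xy∙z≈y∙xz; xy∙z≈x∙zy)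
import Algebra.Properties.CommutativeSemigroup +-commutativeSemigroup as +-CS
open import Data.Nat.Tactic.RingSolver using (solve-∀)
open import Data.Product using (_×_; _,_; proj₂; ∃-syntax)
open import Data.Sum using (_⊎_; inj₁; inj₂)
open import Data.Unit using (tt)
open import Function.Bundles using (Equivalence)
open import Relation.Binary.PropositionalEquality
open import Relation.Nullary using (¬_; yes; no)
open import Defs

sumBelow : ℕ → (ℕ → ℕ) → ℕ
sumBelow zero    f = 0
sumBelow (suc n) f = sumBelow n f + f n

syntax sumBelow n (λ i → e) = ∑[ i < n ] e

sumBelow-mono-≤ : ∀ n {f h : ℕ → ℕ} → (∀ i → i < n → f i ≤ h i) → sumBelow n f ≤ sumBelow n h
sumBelow-mono-≤ zero    f≤h = z≤n
sumBelow-mono-≤ (suc n) f≤h =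
  +-mono-≤ (sumBelow-mono-≤ n (λ i i<n → f≤h i (m<n⇒m<1+n i<n))) (f≤h n ≤-refl)

sumBelow-cong : ∀ n {f h : ℕ → ℕ} → (∀ i → i < n → f i ≡ h i) → sumBelow n f ≡ sumBelow n h
sumBelow-cong zero    f≡h = refl
sumBelow-cong (suc n) f≡h =
  cong₂ _+_ (sumBelow-cong n (λ i i<n → f≡h i (m<n⇒m<1+n i<n))) (f≡h n ≤-refl)

sumBelow-distrib-+ : ∀ n (f h : ℕ → ℕ) →
  ∑[ i < n ] (f i + h i) ≡ sumBelow n f + sumBelow n h
sumBelow-distrib-+ zero    f h = refl
sumBelow-distrib-+ (suc n) f h = begin
  ∑[ i < n ] (f i + h i) + (f n + h n)         ≡⟨ cong (_+ (f n + h n)) (sumBelow-distrib-+ n f h) ⟩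
  sumBelow n f + sumBelow n h + (f n + h n)    ≡⟨ +-CS.interchange (sumBelow n f) (sumBelow n h) (f n) (h n) ⟩
  sumBelow n f + f n + (sumBelow n h + h n)    ∎
  where open ≡-Reasoning

sumBelow-*ˡ : ∀ n c (f : ℕ → ℕ) → ∑[ i < n ] (c * f i) ≡ c * sumBelow n f
sumBelow-*ˡ zero    c f = sym (*-zeroʳ c)
sumBelow-*ˡ (suc n) c f =
  trans (cong (_+ c * f n) (sumBelow-*ˡ n c f)) (sym (*-distribˡ-+ c (sumBelow n f) (f n)))

sumBelow-*ʳ : ∀ n c (f : ℕ → ℕ) → ∑[ i < n ] (f i * c) ≡ sumBelow n f * c
sumBelow-*ʳ n c f = begin
  ∑[ i < n ] (f i * c)   ≡⟨ sumBelow-cong n (λ i _ → *-comm (f i) c) ⟩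
  ∑[ i < n ] (c * f i)   ≡⟨ sumBelow-*ˡ n c f ⟩
  c * sumBelow n f       ≡⟨ *-comm c _ ⟩
  sumBelow n f * c       ∎
  where open ≡-Reasoning

sumBelow-const : ∀ n c → ∑[ i < n ] c ≡ n * c
sumBelow-const zero    c = refl
sumBelow-const (suc n) c = trans (cong (_+ c) (sumBelow-const n c)) (+-comm (n * c) c)

sumBelow-comm : ∀ m n (F : ℕ → ℕ → ℕ) →
  ∑[ i < m ] ∑[ j < n ] F i j ≡ ∑[ j < n ] ∑[ i < m ] F i j
sumBelow-comm zero    n F = sym (trans (sumBelow-const n 0) (*-zeroʳ n))
sumBelow-comm (suc m) n F = begin
  ∑[ i < m ] ∑[ j < n ] F i j + ∑[ j < n ] F m j
    ≡⟨ cong (_+ ∑[ j < n ] F m j) (sumBelow-comm m n F) ⟩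
  ∑[ j < n ] ∑[ i < m ] F i j + ∑[ j < n ] F m j
    ≡⟨ sym (sumBelow-distrib-+ n _ _) ⟩
  ∑[ j < n ] ∑[ i < suc m ] F i j ∎
  where open ≡-Reasoning

sumBelow-+ : ∀ m n (f : ℕ → ℕ) → sumBelow (m + n) f ≡ sumBelow m f + ∑[ i < n ] f (m + i)
sumBelow-+ m zero    f = trans (cong (λ k → sumBelow k f) (+-identityʳ m)) (sym (+-identityʳ _))
sumBelow-+ m (suc n) f = begin
  sumBelow (m + suc n) f                                  ≡⟨ cong (λ k → sumBelow k f) (+-suc m n) ⟩
  sumBelow (m + n) f + f (m + n)                          ≡⟨ cong (_+ f (m + n)) (sumBelow-+ m n f) ⟩
  sumBelow m f + ∑[ i < n ] f (m + i) + f (m + n)         ≡⟨ +-assoc (sumBelow m f) _ _ ⟩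
  sumBelow m f + ∑[ i < suc n ] f (m + i)                 ∎
  where open ≡-Reasoning

sumBelow-* : ∀ m n (f : ℕ → ℕ) → sumBelow (m * n) f ≡ ∑[ k < m ] ∑[ d < n ] f (d + k * n)
sumBelow-* zero    n f = refl
sumBelow-* (suc m) n f = begin
  sumBelow (n + m * n) f                                   ≡⟨ cong (λ k → sumBelow k f) (+-comm n (m * n)) ⟩
  sumBelow (m * n + n) f                                   ≡⟨ sumBelow-+ (m * n) n f ⟩
  sumBelow (m * n) f + ∑[ d < n ] f (m * n + d)
    ≡⟨ cong₂ _+_ (sumBelow-* m n f) (sumBelow-cong n (λ d _ → cong f (+-comm (m * n) d))) ⟩
  ∑[ k < suc m ] ∑[ d < n ] f (d + k * n)                  ∎
  where open ≡-Reasoning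

sumBelow-geometric : ∀ a n → ∑[ d < n ] (a ^ d * suc a ^ (n ∸ suc d)) + a ^ n ≡ suc a ^ n
sumBelow-geometric a zero    = refl
sumBelow-geometric a (suc n) = begin
  ∑[ d < n ] (a ^ d * suc a ^ (suc n ∸ suc d)) + a ^ n * suc a ^ (n ∸ n) + a * a ^ n
    ≡⟨ cong₂ (λ s t → s + a ^ n * suc a ^ t + a * a ^ n) shift (n∸n≡0 n) ⟩
  suc a * Q + a ^ n * 1 + a * a ^ n   ≡⟨ factor a Q (a ^ n) ⟩
  suc a * (Q + a ^ n)                 ≡⟨ cong (suc a *_) (sumBelow-geometric a n) ⟩
  suc a * suc a ^ n                   ∎
  where
  open ≡-Reasoning
  Q = ∑[ d < n ] (a ^ d * suc a ^ (n ∸ suc d))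
  shift : ∑[ d < n ] (a ^ d * suc a ^ (suc n ∸ suc d)) ≡ suc a * Q
  shift = trans (sumBelow-cong n λ d d<n → begin
      a ^ d * suc a ^ (n ∸ d)              ≡⟨ cong (λ k → a ^ d * suc a ^ k) (+-∸-assoc 1 d<n) ⟩
      a ^ d * (suc a * suc a ^ (n ∸ suc d)) ≡⟨ x∙yz≈y∙xz (a ^ d) (suc a) _ ⟩
      suc a * (a ^ d * suc a ^ (n ∸ suc d)) ∎)
    (sumBelow-*ˡ n (suc a) _)
  factor : ∀ a q p → suc a * q + p * 1 + a * p ≡ suc a * (q + p)
  factor = solve-∀

^-distribʳ-* : ∀ m n o → (m * n) ^ o ≡ m ^ o * n ^ o
^-distribʳ-* m n zero    = refl
^-distribʳ-* m n (suc o) = trans (cong (m * n *_) (^-distribʳ-* m n o)) (interchange m n (m ^ o) (n ^ o))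

^-comm : ∀ m n o → (m ^ n) ^ o ≡ (m ^ o) ^ n
^-comm m n o = trans (^-*-assoc m n o) (trans (cong (m ^_) (*-comm n o)) (sym (^-*-assoc m o n)))

^-split : ∀ x {d n} → d ≤ n → x ^ n ≡ x ^ d * x ^ (n ∸ d)
^-split x {d} {n} d≤n = trans (cong (x ^_) (sym (m+[n∸m]≡n d≤n))) (^-distribˡ-+-* x d (n ∸ d))

1≤^ : ∀ {x} n → 1 ≤ x → 1 ≤ x ^ n
1≤^ zero    _   = ≤-refl
1≤^ (suc n) 1≤x = *-mono-≤ 1≤x (1≤^ n 1≤x)

1≤x^x : ∀ x → 1 ≤ x ^ x
1≤x^x zero    = ≤-refl
1≤x^x (suc x) = 1≤^ (suc x) (s≤s z≤n)

^-cancelʳ-≤ : ∀ n {x y} → x ^ suc n ≤ y ^ suc n → x ≤ y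
^-cancelʳ-≤ n {x} {y} x^n≤y^n with x ≤? y
... | yes x≤y = x≤y
... | no  x≰y = ⊥-elim (<⇒≱ (^-monoˡ-< (suc n) (≰⇒> x≰y)) x^n≤y^n)

cube : ℕ → ℕ
cube x = x * x * x

cube-mono-≤ : ∀ {x y} → x ≤ y → cube x ≤ cube y
cube-mono-≤ x≤y = *-mono-≤ (*-mono-≤ x≤y x≤y) x≤y

cube-* : ∀ x y → cube (x * y) ≡ cube x * cube y
cube-* x y = expand x y
  where
  expand : ∀ x y → x * y * (x * y) * (x * y) ≡ x * x * x * (y * y * y)
  expand = solve-∀

cube-^ : ∀ x n → cube (x ^ n) ≡ cube x ^ n
cube-^ x n = trans (cong (_* x ^ n) (sym (^-distribʳ-* x x n))) (sym (^-distribʳ-* (x * x) x n))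

^3≡cube : ∀ x → x ^ 3 ≡ cube x
^3≡cube x = expand x
  where
  expand : ∀ x → x * (x * (x * 1)) ≡ x * x * x
  expand = solve-∀

^-by-3 : ∀ x Y → x ^ Y ≡ x ^ (Y % 3) * cube (x ^ (Y / 3))
^-by-3 x Y = begin
  x ^ Y                              ≡⟨ cong (x ^_) (m≡m%n+[m/n]*n Y 3) ⟩
  x ^ (Y % 3 + Y / 3 * 3)            ≡⟨ ^-distribˡ-+-* x (Y % 3) (Y / 3 * 3) ⟩
  x ^ (Y % 3) * x ^ (Y / 3 * 3)      ≡⟨ cong (x ^ (Y % 3) *_) (trans (sym (^-*-assoc x (Y / 3) 3)) (^3≡cube (x ^ (Y / 3)))) ⟩
  x ^ (Y % 3) * cube (x ^ (Y / 3))   ∎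
  where open ≡-Reasoning

cube-cancel-≤ : ∀ {x y} → cube x ≤ cube y → x ≤ y
cube-cancel-≤ {x} {y} cx≤cy = ^-cancelʳ-≤ 2 (subst₂ _≤_ (sym (^3≡cube x)) (sym (^3≡cube y)) cx≤cy)

bernoulli : ∀ x n → x ^ n * (x + n) ≤ suc x ^ n * x
bernoulli x zero    = ≤-reflexive (cong (1 *_) (+-identityʳ x))
bernoulli x (suc n) = begin
  x * x ^ n * (x + suc n)               ≡⟨ expand x (x ^ n) n ⟩
  x ^ n * (x * x + x * n + x)           ≤⟨ *-monoʳ-≤ (x ^ n) (m≤m+n _ n) ⟩
  x ^ n * (x * x + x * n + x + n)       ≡⟨ factor x (x ^ n) n ⟩
  x ^ n * (x + n) * suc x               ≤⟨ *-monoˡ-≤ (suc x) (bernoulli x n) ⟩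
  suc x ^ n * x * suc x                 ≡⟨ xy∙z≈zx∙y (suc x ^ n) x (suc x) ⟩
  suc x * suc x ^ n * x                 ∎
  where
  open ≤-Reasoning
  expand : ∀ x p n → x * p * (x + suc n) ≡ p * (x * x + x * n + x)
  expand = solve-∀
  factor : ∀ x p n → p * (x * x + x * n + x + n) ≡ p * (x + n) * suc x
  factor = solve-∀

mean-value-^ : ∀ n a → suc a ^ suc n ≤ a ^ suc n + suc n * suc a ^ n
mean-value-^ zero    a = ≤-reflexive (expand a)
  where
  expand : ∀ a → suc a * 1 ≡ a * 1 + 1 * 1
  expand = solve-∀
mean-value-^ (suc n) a = begin
  suc a * suc a ^ suc n                                         ≤⟨ *-monoʳ-≤ (suc a) (mean-value-^ n a) ⟩
  suc a * (a ^ suc n + suc n * suc a ^ n)                        ≡⟨ expand a (a ^ suc n) n (suc a ^ n) ⟩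
  a * a ^ suc n + a ^ suc n + suc n * (suc a * suc a ^ n)
    ≤⟨ +-monoˡ-≤ _ (+-monoʳ-≤ (a * a ^ suc n) (^-monoˡ-≤ (suc n) (n≤1+n a))) ⟩
  a * a ^ suc n + suc a ^ suc n + suc n * (suc a * suc a ^ n)    ≡⟨ collect (a * a ^ suc n) (suc a * suc a ^ n) n ⟩
  a * a ^ suc n + suc (suc n) * (suc a * suc a ^ n)              ∎
  where
  open ≤-Reasoning
  expand : ∀ a A n B → suc a * (A + suc n * B) ≡ a * A + A + suc n * (suc a * B)
  expand = solve-∀
  collect : ∀ X Y n → X + Y + suc n * Y ≡ X + suc (suc n) * Y
  collect = solve-∀

-- Counting words over a finite alphabet

boolToℕ : Bool → ℕ
boolToℕ true  = 1
boolToℕ false = 0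

boolToℕ-∨ : ∀ a b → boolToℕ (a ∨ b) ≤ boolToℕ a + boolToℕ b
boolToℕ-∨ true  b = s≤s z≤n
boolToℕ-∨ false b = ≤-refl

boolToℕ-mono : ∀ {a b} → (T a → T b) → boolToℕ a ≤ boolToℕ b
boolToℕ-mono {false}         _    = z≤n
boolToℕ-mono {true} {true}   _    = ≤-refl
boolToℕ-mono {true} {false}  a⇒b = ⊥-elim (a⇒b tt)

boolToℕ-not : ∀ a → boolToℕ (not a) + boolToℕ a ≡ 1
boolToℕ-not true  = refl
boolToℕ-not false = refl

anyBelow : ℕ → (ℕ → Bool) → Bool
anyBelow zero    p = false
anyBelow (suc n) p = anyBelow n p ∨ p n

T-anyBelow : ∀ n (p : ℕ → Bool) {ℓ} → ℓ < n → T (p ℓ) → T (anyBelow n p)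
T-anyBelow (suc n) p ℓ<1+n pℓ with m≤n⇒m<n∨m≡n (≤-pred ℓ<1+n)
... | inj₁ ℓ<n  = Equivalence.from T-∨ (inj₁ (T-anyBelow n p ℓ<n pℓ))
... | inj₂ refl = Equivalence.from T-∨ (inj₂ pℓ)

module Words (g : ℕ) where
  open ≡-Reasoning

  count : ℕ → (List ℕ → Bool) → ℕ
  count zero    P = boolToℕ (P [])
  count (suc N) P = ∑[ d < g ] count N (λ w → P (d ∷ w))

  count-mono : ∀ N {P Q : List ℕ → Bool} → (∀ w → length w ≡ N → T (P w) → T (Q w)) → count N P ≤ count N Q
  count-mono zero    P⇒Q = boolToℕ-mono (P⇒Q [] refl)
  count-mono (suc N) P⇒Q = sumBelow-mono-≤ g (λ d _ → count-mono N (λ w |w|≡N → P⇒Q (d ∷ w) (cong suc |w|≡N)))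

  count-∨ : ∀ N (P Q : List ℕ → Bool) → count N (λ w → P w ∨ Q w) ≤ count N P + count N Q
  count-∨ zero    P Q = boolToℕ-∨ (P []) (Q [])
  count-∨ (suc N) P Q = ≤-trans (sumBelow-mono-≤ g (λ d _ → count-∨ N _ _))
                                (≤-reflexive (sumBelow-distrib-+ g _ _))

  count-const : ∀ N b → count N (λ _ → b) ≡ boolToℕ b * g ^ N
  count-const zero    b = sym (*-identityʳ (boolToℕ b))
  count-const (suc N) b = begin
    ∑[ d < g ] count N (λ _ → b)   ≡⟨ sumBelow-cong g (λ d _ → count-const N b) ⟩
    ∑[ d < g ] (boolToℕ b * g ^ N) ≡⟨ sumBelow-const g _ ⟩
    g * (boolToℕ b * g ^ N)        ≡⟨ x∙yz≈y∙xz g (boolToℕ b) (g ^ N) ⟩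
    boolToℕ b * (g * g ^ N)        ∎

  count-false : ∀ N → count N (λ _ → false) ≡ 0
  count-false N = count-const N false

  count-∧ : ∀ N b (Q : List ℕ → Bool) → count N (λ w → b ∧ Q w) ≡ (if b then count N Q else 0)
  count-∧ N true  Q = refl
  count-∧ N false Q = count-false N

  count-not : ∀ N (P : List ℕ → Bool) → count N (λ w → not (P w)) + count N P ≡ g ^ N
  count-not zero    P = boolToℕ-not (P [])
  count-not (suc N) P = begin
    ∑[ d < g ] count N (λ w → not (P (d ∷ w))) + ∑[ d < g ] count N (λ w → P (d ∷ w))
      ≡⟨ sym (sumBelow-distrib-+ g _ _) ⟩
    ∑[ d < g ] (count N (λ w → not (P (d ∷ w))) + count N (λ w → P (d ∷ w)))
      ≡⟨ sumBelow-cong g (λ d _ → count-not N _) ⟩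
    ∑[ d < g ] (g ^ N)
      ≡⟨ sumBelow-const g _ ⟩
    g * g ^ N ∎

  count-take : ∀ ℓ R (Q : List ℕ → Bool) → count (ℓ + R) (λ w → Q (take ℓ w)) ≡ count ℓ Q * g ^ R
  count-take zero    R Q = count-const R (Q [])
  count-take (suc ℓ) R Q = begin
    ∑[ d < g ] count (ℓ + R) (λ w → Q (d ∷ take ℓ w))
      ≡⟨ sumBelow-cong g (λ d _ → count-take ℓ R (λ v → Q (d ∷ v))) ⟩
    ∑[ d < g ] (count ℓ (λ v → Q (d ∷ v)) * g ^ R)
      ≡⟨ sumBelow-*ʳ g _ _ ⟩
    count (suc ℓ) Q * g ^ R ∎

  count-anyBelow : ∀ N n (P : ℕ → List ℕ → Bool) →
    count N (λ w → anyBelow n (λ ℓ → P ℓ w)) ≤ ∑[ ℓ < n ] count N (P ℓ)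
  count-anyBelow N zero    P = ≤-reflexive (count-false N)
  count-anyBelow N (suc n) P = ≤-trans (count-∨ N _ _) (+-monoˡ-≤ _ (count-anyBelow N n P))

module BaseExpansion (b : ℕ) where
  g : ℕ
  g = suc (suc b)

  value : List ℕ → ℕ
  value []      = 0
  value (d ∷ w) = d + value w * g

  padded : ℕ → ℕ → List ℕ
  padded zero    n = []
  padded (suc N) n = n % g ∷ padded N (n / g)

  length-padded : ∀ N n → length (padded N n) ≡ N
  length-padded zero    n = refl
  length-padded (suc N) n = cong suc (length-padded N (n / g))

  padded-digits : ∀ N n → All (_< g) (padded N n)
  padded-digits zero    n = []
  padded-digits (suc N) n = m%n<n n g ∷ padded-digits N (n / g)

  [d+k*g]%g≡d : ∀ d k → d < g → (d + k * g) % g ≡ d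
  [d+k*g]%g≡d d k d<g = trans ([m+kn]%n≡m%n d k g) (m<n⇒m%n≡m d<g)

  [d+k*g]/g≡k : ∀ d k → d < g → (d + k * g) / g ≡ k
  [d+k*g]/g≡k d k d<g =
    trans (+-distrib-/-∣ʳ d (divides-refl k)) (cong₂ _+_ (m<n⇒m/n≡0 d<g) (m*n/n≡m k g))

  value-padded : ∀ N n → n < g ^ N → value (padded N n) ≡ n
  value-padded zero    zero    _         = refl
  value-padded zero    (suc n) (s≤s ())
  value-padded (suc N) n       n<g^[1+N] = begin
    n % g + value (padded N (n / g)) * g
      ≡⟨ cong (λ v → n % g + v * g) (value-padded N (n / g) (m<n*o⇒m/o<n n<g^N*g)) ⟩
    n % g + (n / g) * g ≡⟨ sym (m≡m%n+[m/n]*n n g) ⟩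
    n ∎
    where
    open ≡-Reasoning
    n<g^N*g : n < g ^ N * g
    n<g^N*g = subst (n <_) (*-comm g (g ^ N)) n<g^[1+N]

  padded-injective : ∀ N {m n} → m < g ^ N → n < g ^ N → padded N m ≡ padded N n → m ≡ n
  padded-injective N {m} {n} m< n< eq =
    trans (sym (value-padded N m m<)) (trans (cong value eq) (value-padded N n n<))

  value-< : ∀ w → All (_< g) w → value w < g ^ length w
  value-< []      []           = s≤s z≤n
  value-< (d ∷ w) (d<g ∷ w<g) = begin-strict
    d + value w * g     <⟨ +-monoˡ-< (value w * g) d<g ⟩
    suc (value w) * g   ≤⟨ *-monoˡ-≤ g (value-< w w<g) ⟩
    g ^ length w * g    ≡⟨ *-comm (g ^ length w) g ⟩
    g ^ length (d ∷ w)  ∎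
    where open ≤-Reasoning

  value-pos : ∀ w {t} → 0 < t → 0 < value (w ++ t ∷ [])
  value-pos []      0<t = ≤-trans 0<t (m≤m+n _ 0)
  value-pos (d ∷ w) 0<t = ≤-trans (value-pos w 0<t) (≤-trans (m≤m*n _ g) (m≤n+m _ d))

  digitsAux-zero : ∀ F → digitsAux b F 0 ≡ []
  digitsAux-zero zero    = refl
  digitsAux-zero (suc F) = refl

  digitsAux-digit : ∀ F d k → d < g → 0 < d + k * g →
    digitsAux b (suc F) (d + k * g) ≡ d ∷ digitsAux b F k
  digitsAux-digit F d k d<g pos = trans (step (d + k * g) pos)
    (cong₂ _∷_ ([d+k*g]%g≡d d k d<g) (cong (digitsAux b F) ([d+k*g]/g≡k d k d<g)))
    where
    step : ∀ n → 0 < n → digitsAux b (suc F) n ≡ n % g ∷ digitsAux b F (n / g)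
    step (suc n) _ = refl

  digitsAux-value : ∀ F w {t} → All (_< g) (w ++ t ∷ []) → 0 < t → value (w ++ t ∷ []) ≤ F →
    digitsAux b F (value (w ++ t ∷ [])) ≡ w ++ t ∷ []
  digitsAux-value zero    w       _            0<t v≤0   = ⊥-elim (<⇒≱ (value-pos w 0<t) v≤0)
  digitsAux-value (suc F) []      (t<g ∷ [])   0<t _     =
    trans (digitsAux-digit F _ 0 t<g (value-pos [] 0<t)) (cong (_ ∷_) (digitsAux-zero F))
  digitsAux-value (suc F) (d ∷ w) (d<g ∷ w<g) 0<t v≤1+F =
    trans (digitsAux-digit F d v d<g (value-pos (d ∷ w) 0<t))
          (cong (d ∷_) (digitsAux-value F w w<g 0<t (≤-pred (≤-trans v<d+v*g v≤1+F))))
    where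
    v = value (w ++ _ ∷ [])
    v<d+v*g : v < d + v * g
    v<d+v*g = ≤-trans (m<m*n v g {{>-nonZero (value-pos w 0<t)}} (s≤s (s≤s z≤n))) (m≤n+m _ d)

  digits-value : ∀ w {t} → All (_< g) (w ++ t ∷ []) → 0 < t → digits g (value (w ++ t ∷ [])) ≡ w ++ t ∷ []
  digits-value w w<g 0<t = digitsAux-value _ w w<g 0<t ≤-refl

  open Words g

  sumBelow-padded : ∀ N (Q : List ℕ → Bool) → ∑[ n < g ^ N ] boolToℕ (Q (padded N n)) ≡ count N Q
  sumBelow-padded zero    Q = refl
  sumBelow-padded (suc N) Q = begin
    sumBelow (g * g ^ N) F                              ≡⟨ cong (λ m → sumBelow m F) (*-comm g (g ^ N)) ⟩
    sumBelow (g ^ N * g) F                              ≡⟨ sumBelow-* (g ^ N) g F ⟩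
    ∑[ k < g ^ N ] ∑[ d < g ] F (d + k * g)
      ≡⟨ sumBelow-cong (g ^ N) (λ k _ → sumBelow-cong g (λ d d<g →
           cong (λ w → boolToℕ (Q w)) (cong₂ _∷_ ([d+k*g]%g≡d d k d<g) (cong (padded N) ([d+k*g]/g≡k d k d<g))))) ⟩
    ∑[ k < g ^ N ] ∑[ d < g ] boolToℕ (Q (d ∷ padded N k)) ≡⟨ sumBelow-comm (g ^ N) g _ ⟩
    ∑[ d < g ] ∑[ k < g ^ N ] boolToℕ (Q (d ∷ padded N k))
      ≡⟨ sumBelow-cong g (λ d _ → sumBelow-padded N (λ w → Q (d ∷ w))) ⟩
    count (suc N) Q ∎
    where
    open ≡-Reasoning
    F : ℕ → ℕ
    F n = boolToℕ (Q (padded (suc N) n))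

-- Words of low digit sum are exponentially rare

module LowDigitSum (α : ℕ) where
  g : ℕ
  g = suc α

  open Words g

  P : ℕ
  P = ∑[ d < g ] (α ^ d * g ^ (α ∸ d))

  W : ℕ
  W = α ^ α * g ^ α * g ^ α

  -- Chernoff: a word v with sum v ≤ S gets weight (g/α)^(S − sum v) ≥ 1, and the weights
  -- factor over the letters into (P / g^α)^ℓ, where P = g^g − α^g by sumBelow-geometric.
  CountSumBound : ℕ → Set
  CountSumBound ℓ = ∀ S → count ℓ (λ v → sum v ≤ᵇ S) * α ^ S * g ^ (α * ℓ) ≤ g ^ S * P ^ ℓ

  count-sum≤-digit : ∀ ℓ → CountSumBound ℓ → ∀ S d → d ≤ α →
    count ℓ (λ w → d + sum w ≤ᵇ S) * α ^ S * g ^ (α * suc ℓ) ≤ g ^ S * P ^ ℓ * (α ^ d * g ^ (α ∸ d))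
  count-sum≤-digit ℓ bound S d d≤α with d ≤? S
  ... | no d≰S = begin
    c * α ^ S * g ^ (α * suc ℓ)            ≡⟨ cong (λ k → k * α ^ S * g ^ (α * suc ℓ)) (n≤0⇒n≡0 c≤0) ⟩
    0                                      ≤⟨ z≤n ⟩
    g ^ S * P ^ ℓ * (α ^ d * g ^ (α ∸ d))  ∎
    where
    open ≤-Reasoning
    c = count ℓ (λ w → d + sum w ≤ᵇ S)
    c≤0 : c ≤ 0
    c≤0 = ≤-trans (count-mono ℓ (λ w _ d+w≤S → d≰S (≤-trans (m≤m+n d _) (≤ᵇ⇒≤ _ _ d+w≤S))))
                  (≤-reflexive (count-false ℓ))
  ... | yes d≤S = begin
    c * α ^ S * g ^ (α * suc ℓ)
      ≤⟨ *-monoˡ-≤ _ (*-monoˡ-≤ _ c≤c′) ⟩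
    c′ * α ^ S * g ^ (α * suc ℓ)
      ≡⟨ cong₂ (λ a b → c′ * a * b) (^-split α d≤S) (trans (cong (g ^_) (*-suc α ℓ)) (^-distribˡ-+-* g α (α * ℓ))) ⟩
    c′ * (α ^ d * α ^ S′) * (g ^ α * g ^ (α * ℓ))
      ≡⟨ regroup c′ (α ^ d) (α ^ S′) (g ^ α) (g ^ (α * ℓ)) ⟩
    c′ * α ^ S′ * g ^ (α * ℓ) * (α ^ d * g ^ α)
      ≤⟨ *-monoˡ-≤ _ (bound S′) ⟩
    g ^ S′ * P ^ ℓ * (α ^ d * g ^ α)
      ≡⟨ cong (λ k → g ^ S′ * P ^ ℓ * (α ^ d * k)) (^-split g d≤α) ⟩
    g ^ S′ * P ^ ℓ * (α ^ d * (g ^ d * g ^ (α ∸ d)))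
      ≡⟨ regroup′ (g ^ S′) (P ^ ℓ) (α ^ d) (g ^ d) (g ^ (α ∸ d)) ⟩
    g ^ d * g ^ S′ * P ^ ℓ * (α ^ d * g ^ (α ∸ d))
      ≡⟨ cong (λ k → k * P ^ ℓ * (α ^ d * g ^ (α ∸ d))) (sym (^-split g d≤S)) ⟩
    g ^ S * P ^ ℓ * (α ^ d * g ^ (α ∸ d)) ∎
    where
    open ≤-Reasoning
    S′ = S ∸ d
    c = count ℓ (λ w → d + sum w ≤ᵇ S)
    c′ = count ℓ (λ w → sum w ≤ᵇ S′)
    c≤c′ : c ≤ c′
    c≤c′ = count-mono ℓ (λ w _ d+w≤S → ≤⇒≤ᵇ (d+x≤S⇒x≤S∸d (≤ᵇ⇒≤ _ _ d+w≤S)))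
      where
      d+x≤S⇒x≤S∸d : ∀ {x} → d + x ≤ S → x ≤ S ∸ d
      d+x≤S⇒x≤S∸d {x} d+x≤S = subst (_≤ S ∸ d) (m+n∸m≡n d x) (∸-monoˡ-≤ d d+x≤S)
    regroup : ∀ c a₁ a₂ b₁ b₂ → c * (a₁ * a₂) * (b₁ * b₂) ≡ c * a₂ * b₂ * (a₁ * b₁)
    regroup = solve-∀
    regroup′ : ∀ s p a g₁ g₂ → s * p * (a * (g₁ * g₂)) ≡ g₁ * s * p * (a * g₂)
    regroup′ = solve-∀

  count-sum≤ : ∀ ℓ → CountSumBound ℓ
  count-sum≤ zero    S = begin
    1 * α ^ S * g ^ (α * 0)  ≡⟨ cong (λ k → 1 * α ^ S * g ^ k) (*-zeroʳ α) ⟩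
    1 * α ^ S * 1            ≡⟨ trans (*-identityʳ _) (*-identityˡ _) ⟩
    α ^ S                    ≤⟨ ^-monoˡ-≤ S (n≤1+n α) ⟩
    g ^ S                    ≡⟨ sym (*-identityʳ _) ⟩
    g ^ S * 1                ∎
    where open ≤-Reasoning
  count-sum≤ (suc ℓ) S = begin
    sumBelow g c * α ^ S * g ^ (α * suc ℓ)
      ≡⟨ sym (trans (sumBelow-*ʳ g _ (λ d → c d * α ^ S)) (cong (_* g ^ (α * suc ℓ)) (sumBelow-*ʳ g _ c))) ⟩
    ∑[ d < g ] (c d * α ^ S * g ^ (α * suc ℓ))
      ≤⟨ sumBelow-mono-≤ g (λ d d<g → count-sum≤-digit ℓ (count-sum≤ ℓ) S d (≤-pred d<g)) ⟩
    ∑[ d < g ] (g ^ S * P ^ ℓ * (α ^ d * g ^ (α ∸ d)))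
      ≡⟨ sumBelow-*ˡ g (g ^ S * P ^ ℓ) _ ⟩
    g ^ S * P ^ ℓ * P
      ≡⟨ trans (*-assoc (g ^ S) (P ^ ℓ) P) (cong (g ^ S *_) (*-comm (P ^ ℓ) P)) ⟩
    g ^ S * P ^ suc ℓ ∎
    where
    open ≤-Reasoning
    c : ℕ → ℕ
    c d = count ℓ (λ w → d + sum w ≤ᵇ S)

  light : ℕ → List ℕ → Bool
  light ℓ v = 3 * sum v ≤ᵇ α * ℓ

  W^ℓ : ∀ ℓ → α ^ (α * ℓ) * g ^ (α * ℓ) * g ^ (α * ℓ) ≡ W ^ ℓ
  W^ℓ ℓ = begin
    α ^ (α * ℓ) * g ^ (α * ℓ) * g ^ (α * ℓ)
      ≡⟨ cong₂ (λ a b → a * b * b) (sym (^-*-assoc α α ℓ)) (sym (^-*-assoc g α ℓ)) ⟩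
    (α ^ α) ^ ℓ * (g ^ α) ^ ℓ * (g ^ α) ^ ℓ
      ≡⟨ cong (_* (g ^ α) ^ ℓ) (sym (^-distribʳ-* (α ^ α) (g ^ α) ℓ)) ⟩
    (α ^ α * g ^ α) ^ ℓ * (g ^ α) ^ ℓ
      ≡⟨ sym (^-distribʳ-* (α ^ α * g ^ α) (g ^ α) ℓ) ⟩
    W ^ ℓ ∎
    where open ≡-Reasoning

  -- Used at S = ⌊αℓ/3⌋; cubing absorbs the rounding.
  cube-count-light : ∀ ℓ → cube (count ℓ (light ℓ)) * W ^ ℓ ≤ cube P ^ ℓ
  cube-count-light ℓ = subst₂ _≤_ (cong (cube G *_) (W^ℓ ℓ)) (cube-^ P ℓ)
    (*-cancelʳ-≤ _ _ (cube (g ^ S)) {{cube-nonZero}} (begin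
      cube G * (α ^ Y * g ^ Y * g ^ Y) * cube (g ^ S)
        ≤⟨ *-monoˡ-≤ _ (*-monoˡ-≤ _ (cube-mono-≤ G≤G′)) ⟩
      cube G′ * (α ^ Y * g ^ Y * g ^ Y) * cube (g ^ S)
        ≡⟨ cong (λ a → cube G′ * (a * g ^ Y * g ^ Y) * cube (g ^ S)) (^-by-3 α Y) ⟩
      cube G′ * (α ^ r * cube (α ^ S) * g ^ Y * g ^ Y) * cube (g ^ S)
        ≤⟨ *-monoˡ-≤ _ (*-monoʳ-≤ (cube G′)
             (*-monoˡ-≤ _ (*-monoˡ-≤ _ (*-monoˡ-≤ _ (^-monoˡ-≤ r (n≤1+n α)))))) ⟩
      cube G′ * (g ^ r * cube (α ^ S) * g ^ Y * g ^ Y) * cube (g ^ S)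
        ≡⟨ regroup (cube G′) (g ^ r) (cube (α ^ S)) (g ^ Y) (cube (g ^ S)) ⟩
      cube G′ * cube (α ^ S) * g ^ Y * g ^ Y * (g ^ r * cube (g ^ S))
        ≡⟨ cong (λ a → cube G′ * cube (α ^ S) * g ^ Y * g ^ Y * a) (sym (^-by-3 g Y)) ⟩
      cube G′ * cube (α ^ S) * g ^ Y * g ^ Y * g ^ Y
        ≡⟨ sym (cubed G′ (α ^ S) (g ^ Y)) ⟩
      cube (G′ * α ^ S * g ^ Y)
        ≤⟨ cube-mono-≤ (count-sum≤ ℓ S) ⟩
      cube (g ^ S * P ^ ℓ)
        ≡⟨ trans (cube-* (g ^ S) (P ^ ℓ)) (*-comm (cube (g ^ S)) (cube (P ^ ℓ))) ⟩
      cube (P ^ ℓ) * cube (g ^ S) ∎))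
    where
    open ≤-Reasoning
    Y = α * ℓ
    S = Y / 3
    r = Y % 3
    G = count ℓ (light ℓ)
    G′ = count ℓ (λ v → sum v ≤ᵇ S)
    G≤G′ : G ≤ G′
    G≤G′ = count-mono ℓ (λ v _ 3v≤Y → ≤⇒≤ᵇ (subst (_≤ S) (m*n/n≡m (sum v) 3)
                                  (/-monoˡ-≤ 3 (subst (_≤ Y) (*-comm 3 (sum v)) (≤ᵇ⇒≤ _ _ 3v≤Y)))))
    cube-nonZero : NonZero (cube (g ^ S))
    cube-nonZero = >-nonZero (cube-mono-≤ (m^n>0 g S))
    regroup : ∀ c a b y z → c * (a * b * y * y) * z ≡ c * b * y * y * (a * z)
    regroup = solve-∀
    cubed : ∀ a b c → cube (a * b * c) ≡ cube a * cube b * c * c * c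
    cubed a b c = expand a b c
      where
      expand : ∀ a b c → a * b * c * (a * b * c) * (a * b * c) ≡ a * a * a * (b * b * b) * c * c * c
      expand = solve-∀

  -- The hypothesis says that the Chernoff factor per letter, (P / g^(α+1)) (g/α)^(α/3),
  -- is at most 24/25.
  count-light : cube P * cube 25 ≤ cube 24 * cube g * W →
                 ∀ ℓ → count ℓ (light ℓ) * 25 ^ ℓ ≤ 24 ^ ℓ * g ^ ℓ
  count-light P-bound ℓ = cube-cancel-≤ (*-cancelʳ-≤ _ _ (W ^ ℓ) {{W^ℓ-nonZero}} (begin
    cube (G * 25 ^ ℓ) * W ^ ℓ
      ≡⟨ cong (_* W ^ ℓ) (trans (cube-* G (25 ^ ℓ)) (cong (cube G *_) (cube-^ 25 ℓ))) ⟩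
    cube G * cube 25 ^ ℓ * W ^ ℓ
      ≡⟨ xy∙z≈xz∙y (cube G) _ _ ⟩
    cube G * W ^ ℓ * cube 25 ^ ℓ
      ≤⟨ *-monoˡ-≤ _ (cube-count-light ℓ) ⟩
    cube P ^ ℓ * cube 25 ^ ℓ
      ≡⟨ sym (^-distribʳ-* (cube P) (cube 25) ℓ) ⟩
    (cube P * cube 25) ^ ℓ
      ≤⟨ ^-monoˡ-≤ ℓ P-bound ⟩
    (cube 24 * cube g * W) ^ ℓ
      ≡⟨ ^-distribʳ-* (cube 24 * cube g) W ℓ ⟩
    (cube 24 * cube g) ^ ℓ * W ^ ℓ
      ≡⟨ cong (_* W ^ ℓ) (trans (^-distribʳ-* (cube 24) (cube g) ℓ)
                                (sym (trans (cube-* (24 ^ ℓ) (g ^ ℓ)) (cong₂ _*_ (cube-^ 24 ℓ) (cube-^ g ℓ))))) ⟩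
    cube (24 ^ ℓ * g ^ ℓ) * W ^ ℓ ∎))
    where
    open ≤-Reasoning
    G = count ℓ (light ℓ)
    W^ℓ-nonZero : NonZero (W ^ ℓ)
    W^ℓ-nonZero = >-nonZero (1≤^ ℓ (*-mono-≤ (*-mono-≤ (1≤x^x α) (m^n>0 g α)) (m^n>0 g α)))

[1-1/n]^n-increasing : ∀ α → 1 ≤ α → α ^ suc α * suc (suc α) ^ suc (suc α) ≤ suc α ^ suc α * suc α ^ suc (suc α)
[1-1/n]^n-increasing α 1≤α = *-cancelʳ-≤ _ _ x {{x-nonZero}} (begin
  α ^ g * (suc g * suc g ^ g) * x    ≡⟨ regroup (α ^ g) (suc g) (suc g ^ g) x ⟩
  α ^ g * suc g ^ g * (suc g * x)    ≤⟨ *-monoʳ-≤ (α ^ g * suc g ^ g) small ⟩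
  α ^ g * suc g ^ g * (g * (x + g))  ≡⟨ cong (λ y → y * (g * (x + g))) (sym (^-distribʳ-* α (suc g) g)) ⟩
  x ^ g * (g * (x + g))              ≡⟨ x∙yz≈y∙xz (x ^ g) g (x + g) ⟩
  g * (x ^ g * (x + g))              ≤⟨ *-monoʳ-≤ g (bernoulli x g) ⟩
  g * (suc x ^ g * x)                ≡⟨ cong (λ y → g * (y ^ g * x)) suc-x ⟩
  g * ((g * g) ^ g * x)              ≡⟨ cong (λ y → g * (y * x)) (^-distribʳ-* g g g) ⟩
  g * (g ^ g * g ^ g * x)            ≡⟨ regroup′ g (g ^ g) x ⟩
  g ^ g * (g * g ^ g) * x            ∎)
  where
  open ≤-Reasoning
  g = suc α
  x = α * suc g
  x-nonZero : NonZero x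
  x-nonZero = >-nonZero (*-mono-≤ 1≤α (s≤s z≤n))
  suc-x : suc x ≡ g * g
  suc-x = square α
    where
    square : ∀ α → suc (α * suc (suc α)) ≡ suc α * suc α
    square = solve-∀
  small : suc g * x ≤ g * (x + g)
  small = ≤-trans (m≤m+n _ 1) (≤-reflexive (expand α))
    where
    expand : ∀ α → suc (suc α) * (α * suc (suc α)) + 1 ≡ suc α * (α * suc (suc α) + suc α)
    expand = solve-∀
  regroup : ∀ a b c d → a * (b * c) * d ≡ a * c * (b * d)
  regroup = solve-∀
  regroup′ : ∀ g p x → g * (p * p * x) ≡ p * (g * p) * x
  regroup′ = solve-∀

-- Numerals that multiply open terms are kept as variables (here a, b) or in one fixed
-- syntactic form: builtin multiplication only computes on closed literals, and conversion
-- checking would otherwise unfold 15625 * suc _ into thousands of additions.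
[1-1/n]^n-bound-step : ∀ a b α → 1 ≤ α → a * suc α ^ suc α ≤ b * α ^ suc α →
                       a * suc (suc α) ^ suc (suc α) ≤ b * suc α ^ suc (suc α)
[1-1/n]^n-bound-step a b α 1≤α ih = *-cancelʳ-≤ _ _ (α ^ g) {{>-nonZero (1≤^ g 1≤α)}} (begin
  a * (suc g * suc g ^ g) * α ^ g    ≡⟨ regroup a (α ^ g) (suc g * suc g ^ g) ⟩
  a * (α ^ g * (suc g * suc g ^ g))  ≤⟨ *-monoʳ-≤ a ([1-1/n]^n-increasing α 1≤α) ⟩
  a * (g ^ g * (g * g ^ g))          ≡⟨ sym (*-assoc a (g ^ g) _) ⟩
  a * g ^ g * (g * g ^ g)            ≤⟨ *-monoˡ-≤ _ ih ⟩
  b * α ^ g * (g * g ^ g)            ≡⟨ xy∙z≈xz∙y b (α ^ g) _ ⟩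
  b * (g * g ^ g) * α ^ g            ∎)
  where
  open ≤-Reasoning
  g = suc α
  regroup : ∀ a b c → a * c * b ≡ a * (b * c)
  regroup = solve-∀

[5/6]^6≤[1-1/n]^n : ∀ α → 5 ≤ α → 15625 * suc α ^ suc α ≤ 46656 * α ^ suc α
[5/6]^6≤[1-1/n]^n α 5≤α =
  subst (λ a → 15625 * suc a ^ suc a ≤ 46656 * a ^ suc a) (m+[n∸m]≡n 5≤α) (from-five (α ∸ 5))
  where
  from-five : ∀ k → 15625 * suc (5 + k) ^ suc (5 + k) ≤ 46656 * (5 + k) ^ suc (5 + k)
  from-five zero    = ≤ᵇ⇒≤ (15625 * 6 ^ 6) (46656 * 5 ^ 6) tt
  from-five (suc k) = [1-1/n]^n-bound-step 15625 46656 (5 + k) (s≤s z≤n) (from-five k)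

cube-bound-from-ratio : ∀ e f d u v → e ≡ d + f → cube d * cube v ≤ cube u * e * e * f → .{{_ : NonZero e}} →
  ∀ P X Y → P + Y ≡ X → f * X ≤ e * Y → cube P * cube v ≤ cube u * (Y * X * X)
cube-bound-from-ratio e f d u v e≡d+f constant P X Y P+Y≡X ratio =
  *-cancelʳ-≤ _ _ (cube e) {{>-nonZero (cube-mono-≤ (>-nonZero⁻¹ e))}} (begin
    cube P * cube v * cube e         ≡⟨ regroup₁ P v e ⟩
    cube (P * e) * cube v            ≤⟨ *-monoˡ-≤ (cube v) (cube-mono-≤ Pe≤dX) ⟩
    cube (d * X) * cube v            ≡⟨ regroup₂ d X v ⟩
    cube d * cube v * cube X         ≤⟨ *-monoˡ-≤ (cube X) constant ⟩
    cube u * e * e * f * cube X      ≡⟨ regroup₃ u e f X ⟩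
    cube u * e * e * (f * X) * X * X ≤⟨ *-monoˡ-≤ X (*-monoˡ-≤ X (*-monoʳ-≤ (cube u * e * e) ratio)) ⟩
    cube u * e * e * (e * Y) * X * X ≡⟨ regroup₄ u e X Y ⟩
    cube u * (Y * X * X) * cube e    ∎)
  where
  open ≤-Reasoning
  Pe≤dX : P * e ≤ d * X
  Pe≤dX = +-cancelʳ-≤ (f * X) _ _ (begin
    P * e + f * X   ≤⟨ +-monoʳ-≤ (P * e) (≤-trans ratio (≤-reflexive (*-comm e Y))) ⟩
    P * e + Y * e   ≡⟨ sym (*-distribʳ-+ e P Y) ⟩
    (P + Y) * e     ≡⟨ cong₂ _*_ P+Y≡X e≡d+f ⟩
    X * (d + f)     ≡⟨ trans (*-distribˡ-+ X d f) (cong₂ _+_ (*-comm X d) (*-comm X f)) ⟩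
    d * X + f * X   ∎)
  regroup₁ : ∀ P v e → P * P * P * (v * v * v) * (e * e * e) ≡ (P * e) * (P * e) * (P * e) * (v * v * v)
  regroup₁ = solve-∀
  regroup₂ : ∀ d X v → d * X * (d * X) * (d * X) * (v * v * v) ≡ (d * d * d * (v * v * v)) * (X * X * X)
  regroup₂ = solve-∀
  regroup₃ : ∀ u e f X → (u * u * u * e * e * f) * (X * X * X) ≡ u * u * u * e * e * (f * X) * X * X
  regroup₃ = solve-∀
  regroup₄ : ∀ u e X Y → u * u * u * e * e * (e * Y) * X * X ≡ u * u * u * (Y * X * X) * (e * e * e)
  regroup₄ = solve-∀

-- For g ≥ 6 the bound follows from (1 − 1/g)^g ≥ (5/6)^6; the bases 2 to 5 are evaluated.
P-cube-bound : ∀ α → 1 ≤ α → cube (LowDigitSum.P α) * cube 25 ≤ cube 24 * cube (suc α) * LowDigitSum.W α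
P-cube-bound 1 _ = ≤ᵇ⇒≤ _ _ tt
P-cube-bound 2 _ = ≤ᵇ⇒≤ _ _ tt
P-cube-bound 3 _ = ≤ᵇ⇒≤ _ _ tt
P-cube-bound 4 _ = ≤ᵇ⇒≤ _ _ tt
P-cube-bound α@(suc (suc (suc (suc (suc _))))) _ = powers≤ (cube 24)
  (cube-bound-from-ratio 46656 15625 31031 24 25 refl (≤ᵇ⇒≤ _ _ tt)
     P (suc α ^ suc α) (α ^ suc α) (sumBelow-geometric α (suc α))
     ([5/6]^6≤[1-1/n]^n α (s≤s (s≤s (s≤s (s≤s (s≤s z≤n)))))))
  where
  open LowDigitSum α
  powers≤ : ∀ c → cube P * cube 25 ≤ c * (α ^ suc α * suc α ^ suc α * suc α ^ suc α) →
            cube P * cube 25 ≤ c * cube (suc α) * W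
  powers≤ c P≤ = ≤-trans P≤ (≤-trans (≤-reflexive (regroup c α (α ^ α) (suc α) (suc α ^ α)))
    (*-monoˡ-≤ W (*-monoʳ-≤ c (*-monoˡ-≤ (suc α) (*-monoˡ-≤ (suc α) (n≤1+n α))))))
    where
    regroup : ∀ c a A g G → c * (a * A * (g * G) * (g * G)) ≡ c * (a * g * g) * (A * G * G)
    regroup = solve-∀

-- Comparing with the logarithm

module ExponentialSeries (p : ℕ) where
  n : ℕ
  n = suc p

  -- scaled K a = K! · n^K · Σ_{k ≤ K} (a/n)^k / k!, so that scaled K (n * ℓ) = n^K · expNum ℓ K.
  -- Raising a by one multiplies it by at most n/p, hence Σ_{k ≤ K} ℓ^k / k! ≤ (n/p)^(nℓ).
  scaled : ℕ → ℕ → ℕ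
  scaled zero    a = 1
  scaled (suc K) a = suc K * n * scaled K a + a ^ suc K

  scaled-suc : ∀ K a → scaled (suc K) (suc a) ≤ scaled (suc K) a + suc K * scaled K (suc a)
  scaled-suc zero    a = ≤-reflexive (expand n a)
    where
    expand : ∀ n a → 1 * n * 1 + suc a * 1 ≡ 1 * n * 1 + a * 1 + 1 * 1
    expand = solve-∀
  scaled-suc (suc K) a = begin
    k * n * scaled (suc K) (suc a) + suc a ^ k
      ≤⟨ +-monoˡ-≤ _ (*-monoʳ-≤ (k * n) (scaled-suc K a)) ⟩
    k * n * (scaled (suc K) a + suc K * scaled K (suc a)) + suc a ^ k
      ≤⟨ +-monoʳ-≤ (k * n * (scaled (suc K) a + suc K * scaled K (suc a))) (mean-value-^ (suc K) a) ⟩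
    k * n * (scaled (suc K) a + suc K * scaled K (suc a)) + (a ^ k + k * suc a ^ suc K)
      ≡⟨ regroup k n (scaled (suc K) a) (suc K) (scaled K (suc a)) (a ^ k) (suc a ^ suc K) ⟩
    k * n * scaled (suc K) a + a ^ k + k * (suc K * n * scaled K (suc a) + suc a ^ suc K) ∎
    where
    open ≤-Reasoning
    k = suc (suc K)
    regroup : ∀ k n Y j Z A B → k * n * (Y + j * Z) + (A + k * B) ≡ k * n * Y + A + k * (j * n * Z + B)
    regroup = solve-∀

  scaled-ratio : ∀ K a → p * scaled K (suc a) ≤ n * scaled K a
  scaled-ratio zero    a = n≤1+n (p * 1)
  scaled-ratio (suc K) a = +-cancelˡ-≤ X _ _ (begin
    n * X                               ≤⟨ *-monoʳ-≤ n (scaled-suc K a) ⟩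
    n * (Y + suc K * Z)                 ≡⟨ expand n Y (suc K) Z ⟩
    n * Y + suc K * n * Z               ≤⟨ +-monoʳ-≤ (n * Y) (m≤m+n _ _) ⟩
    n * Y + X                           ≡⟨ +-comm (n * Y) X ⟩
    X + n * Y                           ∎)
    where
    open ≤-Reasoning
    X = scaled (suc K) (suc a)
    Y = scaled (suc K) a
    Z = scaled K (suc a)
    expand : ∀ n Y k Z → n * (Y + k * Z) ≡ n * Y + k * n * Z
    expand = solve-∀

  scaled-growth : ∀ K a → p ^ a * scaled K a ≤ n ^ a * scaled K 0
  scaled-growth K zero    = ≤-refl
  scaled-growth K (suc a) = begin
    p * p ^ a * scaled K (suc a)   ≡⟨ xy∙z≈y∙xz p (p ^ a) _ ⟩
    p ^ a * (p * scaled K (suc a)) ≤⟨ *-monoʳ-≤ (p ^ a) (scaled-ratio K a) ⟩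
    p ^ a * (n * scaled K a)       ≡⟨ x∙yz≈y∙xz (p ^ a) n _ ⟩
    n * (p ^ a * scaled K a)       ≤⟨ *-monoʳ-≤ n (scaled-growth K a) ⟩
    n * (n ^ a * scaled K 0)       ≡⟨ sym (*-assoc n (n ^ a) _) ⟩
    n * n ^ a * scaled K 0         ∎
    where open ≤-Reasoning

  scaled-zero : ∀ K → scaled K 0 ≡ n ^ K * K !
  scaled-zero zero    = refl
  scaled-zero (suc K) = trans (cong (λ s → suc K * n * s + 0) (scaled-zero K)) (regroup (suc K) n (n ^ K) (K !))
    where
    regroup : ∀ k n N f → k * n * (N * f) + 0 ≡ n * N * (k * f)
    regroup = solve-∀

  scaled-expNum : ∀ K ℓ → scaled K (n * ℓ) ≡ n ^ K * expNum ℓ K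
  scaled-expNum zero    ℓ = refl
  scaled-expNum (suc K) ℓ = begin
    suc K * n * scaled K (n * ℓ) + (n * ℓ) ^ suc K
      ≡⟨ cong₂ (λ s t → suc K * n * s + t) (scaled-expNum K ℓ) (^-distribʳ-* n ℓ (suc K)) ⟩
    suc K * n * (n ^ K * expNum ℓ K) + n * n ^ K * ℓ ^ suc K
      ≡⟨ regroup (suc K) n (n ^ K) (expNum ℓ K) (ℓ ^ suc K) ⟩
    n * n ^ K * (suc K * expNum ℓ K + ℓ ^ suc K) ∎
    where
    open ≡-Reasoning
    regroup : ∀ k n N E Lk → k * n * (N * E) + n * N * Lk ≡ n * N * (k * E + Lk)
    regroup = solve-∀

  expNum-bound : ∀ K ℓ → p ^ (n * ℓ) * expNum ℓ K ≤ n ^ (n * ℓ) * K !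
  expNum-bound K ℓ = *-cancelʳ-≤ _ _ (n ^ K) {{m^n≢0 n K}} (begin
    p ^ (n * ℓ) * expNum ℓ K * n ^ K    ≡⟨ xy∙z≈x∙zy (p ^ (n * ℓ)) (expNum ℓ K) (n ^ K) ⟩
    p ^ (n * ℓ) * (n ^ K * expNum ℓ K)  ≡⟨ cong (p ^ (n * ℓ) *_) (sym (scaled-expNum K ℓ)) ⟩
    p ^ (n * ℓ) * scaled K (n * ℓ)      ≤⟨ scaled-growth K (n * ℓ) ⟩
    n ^ (n * ℓ) * scaled K 0            ≡⟨ cong (n ^ (n * ℓ) *_) (scaled-zero K) ⟩
    n ^ (n * ℓ) * (n ^ K * K !)         ≡⟨ x∙yz≈xz∙y (n ^ (n * ℓ)) (n ^ K) (K !) ⟩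
    n ^ (n * ℓ) * K ! * n ^ K           ∎)
    where open ≤-Reasoning

  LogLe⇒^-bound : ∀ L ℓ → LogLe L ℓ → L ^ 36 * (p ^ n) ^ ℓ ≤ (n ^ n) ^ ℓ
  LogLe⇒^-bound L ℓ (K , L^36*K!≤expNum) =
    subst₂ (λ a b → L ^ 36 * a ≤ b) (sym (^-*-assoc p n ℓ)) (sym (^-*-assoc n n ℓ))
      (*-cancelʳ-≤ _ _ (K !) {{K !≢0}} (begin
        L ^ 36 * p ^ (n * ℓ) * K !    ≡⟨ xy∙z≈y∙xz (L ^ 36) (p ^ (n * ℓ)) (K !) ⟩
        p ^ (n * ℓ) * (L ^ 36 * K !)  ≤⟨ *-monoʳ-≤ (p ^ (n * ℓ)) L^36*K!≤expNum ⟩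
        p ^ (n * ℓ) * expNum ℓ K      ≤⟨ expNum-bound K ℓ ⟩
        n ^ (n * ℓ) * K !             ∎))
    where open ≤-Reasoning

-- Long L k says L^36 ≤ ((6/5)^6)^k; as (6/5)^6 > e it follows from 36 log L ≤ k.
Long : ℕ → ℕ → Set
Long L k = L ^ 36 * 15625 ^ k ≤ 46656 ^ k

LogLe⇒Long : ∀ L k → LogLe L k → Long L k
LogLe⇒Long = ExponentialSeries.LogLe⇒^-bound 5

Long-mono : ∀ L k z → Long L k → Long L (k + z)
Long-mono L k z long = begin
  L ^ 36 * 15625 ^ (k + z)            ≡⟨ cong (L ^ 36 *_) (^-distribˡ-+-* 15625 k z) ⟩
  L ^ 36 * (15625 ^ k * 15625 ^ z)    ≡⟨ sym (*-assoc (L ^ 36) _ _) ⟩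
  L ^ 36 * 15625 ^ k * 15625 ^ z      ≤⟨ *-mono-≤ long (^-monoˡ-≤ z (≤ᵇ⇒≤ 15625 46656 _)) ⟩
  46656 ^ k * 46656 ^ z               ≡⟨ sym (^-distribˡ-+-* 46656 k z) ⟩
  46656 ^ (k + z)                     ∎
  where open ≤-Reasoning

module _ (a u v E F : ℕ) (1≤E : 1 ≤ E) (1≤F : 1 ≤ F)
         (constant : (E * u ^ 36) ^ 6 * E ≤ (F * v ^ 36) ^ 6 * F) where

  X-large : ∀ L X c → E ^ c * a ^ 6 ≤ L → L ^ 36 * (F ^ X * F ^ c) ≤ E ^ X * E ^ c →
            (a ^ 6) ^ 36 * (E ^ c) ^ 6 * F ^ X ≤ E ^ X * (F ^ c) ^ 6
  X-large L X c L-large L-small = begin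
    (a ^ 6) ^ 36 * Ec ^ 6 * FX
      ≤⟨ *-monoˡ-≤ FX (*-monoʳ-≤ ((a ^ 6) ^ 36) (^-monoʳ-≤ Ec {{>-nonZero 1≤Ec}} (≤ᵇ⇒≤ 6 35 _))) ⟩
    (a ^ 6) ^ 36 * Ec ^ 35 * FX       ≤⟨ m≤m*n _ Fc {{>-nonZero 1≤Fc}} ⟩
    (a ^ 6) ^ 36 * Ec ^ 35 * FX * Fc  ≤⟨ *-cancelʳ-≤ _ _ Ec {{>-nonZero 1≤Ec}} (begin
        (a ^ 6) ^ 36 * Ec ^ 35 * FX * Fc * Ec  ≡⟨ regroup ((a ^ 6) ^ 36) (Ec ^ 35) FX Fc Ec ⟩
        (a ^ 6) ^ 36 * Ec ^ 36 * (FX * Fc)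
          ≡⟨ cong (_* (FX * Fc)) (trans (*-comm ((a ^ 6) ^ 36) (Ec ^ 36)) (sym (^-distribʳ-* Ec (a ^ 6) 36))) ⟩
        (Ec * a ^ 6) ^ 36 * (FX * Fc)          ≤⟨ *-monoˡ-≤ (FX * Fc) (^-monoˡ-≤ 36 L-large) ⟩
        L ^ 36 * (FX * Fc)                     ≤⟨ L-small ⟩
        EX * Ec                                ∎) ⟩
    EX                                ≤⟨ m≤m*n EX (Fc ^ 6) {{>-nonZero (1≤^ 6 1≤Fc)}} ⟩
    EX * Fc ^ 6                       ∎
    where
    open ≤-Reasoning
    Ec = E ^ c
    Fc = F ^ c
    EX = E ^ X
    FX = F ^ X
    1≤Ec : 1 ≤ Ec
    1≤Ec = 1≤^ c 1≤E
    1≤Fc : 1 ≤ Fc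
    1≤Fc = 1≤^ c 1≤F
    regroup : ∀ a e′ f c e → a * e′ * f * c * e ≡ a * (e * e′) * (f * c)
    regroup = solve-∀

  ratio-bound : ∀ X c → (a ^ 6) ^ 36 * (E ^ c) ^ 6 * F ^ X ≤ E ^ X * (F ^ c) ^ 6 →
                a ^ 36 * E ^ c * (E * u ^ 36) ^ X ≤ F ^ c * (F * v ^ 36) ^ X
  ratio-bound X c large = ^-cancelʳ-≤ 5 (*-cancelʳ-≤ _ _ EX {{>-nonZero (1≤^ X 1≤E)}} (begin
    (a ^ 36 * Ec * A ^ X) ^ 6 * EX             ≡⟨ cong (_* EX) (^-distribʳ-* (a ^ 36 * Ec) (A ^ X) 6) ⟩
    (a ^ 36 * Ec) ^ 6 * (A ^ X) ^ 6 * EX       ≡⟨ *-assoc ((a ^ 36 * Ec) ^ 6) ((A ^ X) ^ 6) EX ⟩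
    (a ^ 36 * Ec) ^ 6 * ((A ^ X) ^ 6 * EX)     ≤⟨ *-monoʳ-≤ ((a ^ 36 * Ec) ^ 6) constant^X ⟩
    (a ^ 36 * Ec) ^ 6 * ((B ^ X) ^ 6 * FX)
      ≡⟨ cong (_* ((B ^ X) ^ 6 * FX)) (trans (^-distribʳ-* (a ^ 36) Ec 6) (cong (_* Ec ^ 6) (^-comm a 36 6))) ⟩
    (a ^ 6) ^ 36 * Ec ^ 6 * ((B ^ X) ^ 6 * FX) ≡⟨ x∙yz≈xz∙y ((a ^ 6) ^ 36 * Ec ^ 6) ((B ^ X) ^ 6) FX ⟩
    (a ^ 6) ^ 36 * Ec ^ 6 * FX * (B ^ X) ^ 6   ≤⟨ *-monoˡ-≤ ((B ^ X) ^ 6) large ⟩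
    EX * Fc ^ 6 * (B ^ X) ^ 6                  ≡⟨ rotate EX (Fc ^ 6) ((B ^ X) ^ 6) ⟩
    Fc ^ 6 * (B ^ X) ^ 6 * EX                  ≡⟨ cong (_* EX) (sym (^-distribʳ-* Fc (B ^ X) 6)) ⟩
    (Fc * B ^ X) ^ 6 * EX                      ∎))
    where
    open ≤-Reasoning
    Ec = E ^ c
    Fc = F ^ c
    EX = E ^ X
    FX = F ^ X
    A = E * u ^ 36
    B = F * v ^ 36
    constant^X : (A ^ X) ^ 6 * EX ≤ (B ^ X) ^ 6 * FX
    constant^X = subst₂ _≤_
      (trans (^-distribʳ-* (A ^ 6) E X) (cong (_* EX) (^-comm A 6 X)))
      (trans (^-distribʳ-* (B ^ 6) F X) (cong (_* FX) (^-comm B 6 X)))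
      (^-monoˡ-≤ X constant)
    rotate : ∀ e f b → e * f * b ≡ f * b * e
    rotate = solve-∀

  ^-beats-linear : ∀ L X c → E ^ c * a ^ 6 ≤ L → L ^ 36 * F ^ (X + c) ≤ E ^ (X + c) →
                   a * L * u ^ X ≤ v ^ X
  ^-beats-linear L X c L-large L-small = ^-cancelʳ-≤ 35 (*-cancelʳ-≤ _ _ (FX * Fc) {{FX*Fc-nonZero}} (begin
    (a * L * u ^ X) ^ 36 * (FX * Fc)
      ≡⟨ cong (_* (FX * Fc)) (trans (^-distribʳ-* (a * L) (u ^ X) 36) (cong (_* (u ^ X) ^ 36) (^-distribʳ-* a L 36))) ⟩
    a ^ 36 * L ^ 36 * (u ^ X) ^ 36 * (FX * Fc)   ≡⟨ regroup₁ (a ^ 36) (L ^ 36) ((u ^ X) ^ 36) (FX * Fc) ⟩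
    a ^ 36 * (u ^ X) ^ 36 * (L ^ 36 * (FX * Fc)) ≤⟨ *-monoʳ-≤ (a ^ 36 * (u ^ X) ^ 36) L-small′ ⟩
    a ^ 36 * (u ^ X) ^ 36 * (EX * Ec)            ≡⟨ regroup₂ (a ^ 36) ((u ^ X) ^ 36) EX Ec ⟩
    a ^ 36 * Ec * (EX * (u ^ X) ^ 36)            ≡⟨ cong (a ^ 36 * Ec *_) (sym (power^X E u)) ⟩
    a ^ 36 * Ec * (E * u ^ 36) ^ X               ≤⟨ ratio-bound X c (X-large L X c L-large L-small′) ⟩
    Fc * (F * v ^ 36) ^ X                        ≡⟨ cong (Fc *_) (power^X F v) ⟩
    Fc * (FX * (v ^ X) ^ 36)                     ≡⟨ regroup₃ Fc FX ((v ^ X) ^ 36) ⟩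
    (v ^ X) ^ 36 * (FX * Fc)                     ∎))
    where
    open ≤-Reasoning
    Ec = E ^ c
    Fc = F ^ c
    EX = E ^ X
    FX = F ^ X
    FX*Fc-nonZero : NonZero (FX * Fc)
    FX*Fc-nonZero = >-nonZero (*-mono-≤ (1≤^ X 1≤F) (1≤^ c 1≤F))
    L-small′ : L ^ 36 * (FX * Fc) ≤ EX * Ec
    L-small′ = subst₂ (λ x y → L ^ 36 * x ≤ y) (^-distribˡ-+-* F X c) (^-distribˡ-+-* E X c) L-small
    power^X : ∀ B w → (B * w ^ 36) ^ X ≡ B ^ X * (w ^ X) ^ 36
    power^X B w = trans (^-distribʳ-* B (w ^ 36) X) (cong (B ^ X *_) (^-comm w 36 X))
    regroup₁ : ∀ a l u f → a * l * u * f ≡ a * u * (l * f)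
    regroup₁ = solve-∀
    regroup₂ : ∀ a u e c → a * u * (e * c) ≡ a * c * (e * u)
    regroup₂ = solve-∀
    regroup₃ : ∀ c f v → c * (f * v) ≡ v * (f * c)
    regroup₃ = solve-∀

-- Substrings and digit weight

IsPrefix : List ℕ → List ℕ → Set
IsPrefix p w = ∃[ s ] (w ≡ p ++ s)

IsSuffix : List ℕ → List ℕ → Set
IsSuffix s w = ∃[ p ] (w ≡ p ++ s)

++-≡-++ : ∀ (v ys p s : List ℕ) → v ++ ys ≡ p ++ s →
  IsPrefix v p ⊎ ∃[ s₁ ] (v ≡ p ++ s₁ × IsPrefix s₁ s)
++-≡-++ []      ys p       s eq = inj₁ (p , refl)
++-≡-++ (x ∷ v) ys []      s eq = inj₂ (x ∷ v , refl , ys , sym eq)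
++-≡-++ (x ∷ v) ys (y ∷ p) s eq with ∷-injective eq
... | refl , eq′ with ++-≡-++ v ys p s eq′
...   | inj₁ (p₂ , p≡v++p₂)           = inj₁ (p₂ , cong (x ∷_) p≡v++p₂)
...   | inj₂ (s₁ , v≡p++s₁ , s-pre)   = inj₂ (s₁ , cong (x ∷_) v≡p++s₁ , s-pre)

IsSubstring-++ : ∀ {v} p s → IsSubstring v (p ++ s) →
  IsSubstring v p ⊎ IsSubstring v s ⊎ ∃[ p₂ ] ∃[ s₁ ] (v ≡ p₂ ++ s₁ × IsSuffix p₂ p × IsPrefix s₁ s)
IsSubstring-++ []      s (xs , ys , eq) = inj₂ (inj₁ (xs , ys , eq))
IsSubstring-++ {v} (y ∷ p) s ([] , ys , eq) with ++-≡-++ v ys (y ∷ p) s (sym eq)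
... | inj₁ (p₂ , p≡v++p₂)         = inj₁ ([] , p₂ , p≡v++p₂)
... | inj₂ (s₁ , v≡p++s₁ , s-pre) = inj₂ (inj₂ (y ∷ p , s₁ , v≡p++s₁ , ([] , refl) , s-pre))
IsSubstring-++ (y ∷ p) s (x ∷ xs , ys , eq) with ∷-injective eq
... | refl , eq′ with IsSubstring-++ p s (xs , ys , eq′)
...   | inj₁ (xs₁ , ys₁ , p≡)                        = inj₁ (x ∷ xs₁ , ys₁ , cong (x ∷_) p≡)
...   | inj₂ (inj₁ v⊑s)                              = inj₂ (inj₁ v⊑s)
...   | inj₂ (inj₂ (p₂ , s₁ , v≡ , (p₁ , p≡) , s-pre)) =
        inj₂ (inj₂ (p₂ , s₁ , v≡ , (x ∷ p₁ , cong (x ∷_) p≡) , s-pre))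

IsSubstring-refl : ∀ w → IsSubstring w w
IsSubstring-refl w = [] , [] , sym (++-identityʳ w)

IsSuffix⇒IsSubstring : ∀ {s w} → IsSuffix s w → IsSubstring s w
IsSuffix⇒IsSubstring {s} (p , w≡p++s) = p , [] , trans w≡p++s (cong (p ++_) (sym (++-identityʳ s)))

IsSubstring-length : ∀ {v w : List ℕ} → IsSubstring v w → length v ≤ length w
IsSubstring-length {v} (xs , ys , refl) = begin
  length v                           ≤⟨ m≤n+m (length v) (length xs) ⟩
  length xs + length v               ≤⟨ +-monoʳ-≤ (length xs) (m≤m+n (length v) (length ys)) ⟩
  length xs + (length v + length ys) ≡⟨ sym (trans (length-++ xs) (cong (length xs +_) (length-++ v))) ⟩
  length (xs ++ v ++ ys)             ∎
  where open ≤-Reasoning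

IsSubstring-++₃ : ∀ {v} a u t → IsSubstring v (a ++ u ++ t) →
  IsSubstring v a ⊎ IsSubstring v t ⊎
  ∃[ a₂ ] ∃[ u′ ] ∃[ t₁ ] (v ≡ a₂ ++ u′ ++ t₁ × IsSuffix a₂ a × IsSubstring u′ u × IsPrefix t₁ t)
IsSubstring-++₃ {v} a u t v⊑aut with IsSubstring-++ a (u ++ t) v⊑aut
... | inj₁ v⊑a = inj₁ v⊑a
... | inj₂ (inj₁ v⊑ut) with IsSubstring-++ u t v⊑ut
...   | inj₁ v⊑u = inj₂ (inj₂ ([] , v , [] , sym (++-identityʳ v) , (a , sym (++-identityʳ a)) , v⊑u , (t , refl)))
...   | inj₂ (inj₁ v⊑t) = inj₂ (inj₁ v⊑t)
...   | inj₂ (inj₂ (u₂ , t₁ , v≡ , u-suf , t-pre)) =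
        inj₂ (inj₂ ([] , u₂ , t₁ , v≡ , (a , sym (++-identityʳ a)) , IsSuffix⇒IsSubstring u-suf , t-pre))
IsSubstring-++₃ {v} a u t v⊑aut | inj₂ (inj₂ (a₂ , s₁ , v≡ , a-suf , (s₂ , ut≡))) with ++-≡-++ s₁ s₂ u t (sym ut≡)
... | inj₁ (u₂ , u≡s₁++u₂) =
      inj₂ (inj₂ (a₂ , s₁ , [] , trans v≡ (cong (a₂ ++_) (sym (++-identityʳ s₁))) , a-suf ,
                  ([] , u₂ , u≡s₁++u₂) , (t , refl)))
... | inj₂ (t₁ , s₁≡u++t₁ , t-pre) =
      inj₂ (inj₂ (a₂ , u , t₁ , trans v≡ (cong (a₂ ++_) s₁≡u++t₁) , a-suf , IsSubstring-refl u , t-pre))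

module DigitWeight (α : ℕ) where
  Balanced : List ℕ → Set
  Balanced v = α * length v ≤ 3 * sum v

  Heavy : List ℕ → Set
  Heavy v = α * length v < 3 * sum v

  weight-++ : ∀ x y → α * length (x ++ y) ≡ α * length x + α * length y × 3 * sum (x ++ y) ≡ 3 * sum x + 3 * sum y
  weight-++ x y = trans (cong (α *_) (length-++ x)) (*-distribˡ-+ α (length x) (length y))
                , trans (cong (3 *_) (sum-++ x y)) (*-distribˡ-+ 3 (sum x) (sum y))

  Balanced-++ : ∀ x y → Balanced x → Balanced y → Balanced (x ++ y)
  Balanced-++ x y bx by with weight-++ x y
  ... | l≡ , s≡ = subst₂ _≤_ (sym l≡) (sym s≡) (+-mono-≤ bx by)

  Heavy-++ˡ : ∀ x y → Heavy x → Balanced y → Heavy (x ++ y)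
  Heavy-++ˡ x y hx by with weight-++ x y
  ... | l≡ , s≡ = subst₂ _<_ (sym l≡) (sym s≡) (+-mono-<-≤ hx by)

  Heavy-++ʳ : ∀ x y → Balanced x → Heavy y → Heavy (x ++ y)
  Heavy-++ʳ x y bx hy with weight-++ x y
  ... | l≡ , s≡ = subst₂ _<_ (sym l≡) (sym s≡) (+-mono-≤-< bx hy)

  ¬Heavy[] : ¬ Heavy []
  ¬Heavy[] h = <-irrefl refl (≤-trans h (≤-reflexive (sym (*-zeroʳ α))))

  interleave : List ℕ → List ℕ
  interleave []       = []
  interleave (x ∷ xs) = x ∷ α ∷ interleave xs

  Balanced-interleave : ∀ xs → Balanced (interleave xs)
  Balanced-interleave []       = ≤-reflexive (*-zeroʳ α)
  Balanced-interleave (x ∷ xs) = Balanced-++ (x ∷ α ∷ []) (interleave xs) pair (Balanced-interleave xs)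
    where
    pair : α * 2 ≤ 3 * (x + (α + 0))
    pair = ≤-trans (*-monoʳ-≤ α (≤ᵇ⇒≤ 2 3 _)) (≤-trans (≤-reflexive (*-comm α 3))
             (*-monoʳ-≤ 3 (≤-trans (m≤m+n α 0) (m≤n+m (α + 0) x))))

  Balanced-[α] : Balanced (α ∷ [])
  Balanced-[α] = ≤-trans (≤-reflexive (*-identityʳ α)) (≤-trans (m≤m+n α 0) (m≤n*m (α + 0) 3))

  [α]-prefix-Balanced : ∀ p → IsPrefix p (α ∷ []) → Balanced p
  [α]-prefix-Balanced []          _        = ≤-reflexive (*-zeroʳ α)
  [α]-prefix-Balanced (_ ∷ [])    (_ , refl) = Balanced-[α]
  [α]-prefix-Balanced (_ ∷ _ ∷ _) (_ , ())

  interleave-suffix-Balanced : ∀ xs s → IsSuffix s (interleave xs) → Balanced s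
  interleave-suffix-Balanced []       s ([] , refl) = ≤-reflexive (*-zeroʳ α)
  interleave-suffix-Balanced (x ∷ xs) s ([] , refl) = Balanced-interleave (x ∷ xs)
  interleave-suffix-Balanced (x ∷ xs) s (_ ∷ [] , refl) =
    Balanced-++ (α ∷ []) (interleave xs) Balanced-[α] (Balanced-interleave xs)
  interleave-suffix-Balanced (x ∷ xs) s (_ ∷ _ ∷ p , eq) with ∷-injective eq
  ... | _ , eq′ = interleave-suffix-Balanced xs s (p , proj₂ (∷-injective eq′))

  length-interleave : ∀ xs → length (interleave xs) ≡ length xs + length xs
  length-interleave []       = refl
  length-interleave (x ∷ xs) = cong suc (trans (cong suc (length-interleave xs)) (sym (+-suc (length xs) (length xs))))

  sum-interleave : ∀ xs → sum (interleave xs) ≡ sum xs + length xs * α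
  sum-interleave []       = refl
  sum-interleave (x ∷ xs) = trans (cong (λ s → x + (α + s)) (sum-interleave xs)) (regroup x α (sum xs) (length xs))
    where
    regroup : ∀ x α s n → x + (α + (s + n * α)) ≡ x + s + (α + n * α)
    regroup = solve-∀

  module _ (IsLong : ℕ → Set) (IsLong-mono : ∀ k z → IsLong k → IsLong (k + z)) (c : ℕ) where
    IsLong-≤ : ∀ {k k′} → k ≤ k′ → IsLong k → IsLong k′
    IsLong-≤ {k} k≤k′ long = subst IsLong (m+[n∸m]≡n k≤k′) (IsLong-mono k _ long)

    ¬IsLong-short : ∀ u → (∀ v → IsSubstring v u → IsLong (length v + c) → Heavy v) → ∀ {k} → k ≤ c → ¬ IsLong k
    ¬IsLong-short u u-heavy k≤c long = ¬Heavy[] (u-heavy [] ([] , u , refl) (IsLong-≤ k≤c long))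

    Heavy-padded : ∀ a u t → (∀ s → IsSuffix s a → Balanced s) → (∀ p → IsPrefix p t → Balanced p) →
      length a + length t ≤ c → (∀ v → IsSubstring v u → IsLong (length v + c) → Heavy v) →
      ∀ v → IsSubstring v (a ++ u ++ t) → IsLong (length v) → Heavy v
    Heavy-padded a u t a-balanced t-balanced a+t≤c u-heavy v v⊑aut long with IsSubstring-++₃ a u t v⊑aut
    ... | inj₁ v⊑a        =
      ⊥-elim (¬IsLong-short u u-heavy (≤-trans (IsSubstring-length v⊑a) (≤-trans (m≤m+n _ _) a+t≤c)) long)
    ... | inj₂ (inj₁ v⊑t) =
      ⊥-elim (¬IsLong-short u u-heavy (≤-trans (IsSubstring-length v⊑t) (≤-trans (m≤n+m _ _) a+t≤c)) long)
    ... | inj₂ (inj₂ (a₂ , u′ , t₁ , refl , a-suf , u′⊑u , t-pre@(t₂ , t≡))) =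
      Heavy-++ʳ a₂ (u′ ++ t₁) (a-balanced a₂ a-suf)
        (Heavy-++ˡ u′ t₁ (u-heavy u′ u′⊑u (IsLong-≤ length≤ long)) (t-balanced t₁ t-pre))
      where
      open ≤-Reasoning
      length≤ : length (a₂ ++ u′ ++ t₁) ≤ length u′ + c
      length≤ = begin
        length (a₂ ++ u′ ++ t₁)                 ≡⟨ trans (length-++ a₂) (cong (length a₂ +_) (length-++ u′)) ⟩
        length a₂ + (length u′ + length t₁)     ≡⟨ +-CS.x∙yz≈y∙xz (length a₂) (length u′) (length t₁) ⟩
        length u′ + (length a₂ + length t₁)     ≤⟨ +-monoʳ-≤ (length u′) (+-mono-≤
                                                     (IsSubstring-length (IsSuffix⇒IsSubstring a-suf))
                                                     (IsSubstring-length ([] , t₂ , t≡))) ⟩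
        length u′ + (length a + length t)       ≤⟨ +-monoʳ-≤ (length u′) a+t≤c ⟩
        length u′ + c                           ∎

module BadWords (α : ℕ) (long : ℕ → Bool) where
  open LowDigitSum α using (g; light)
  open DigitWeight α using (Heavy)
  open Words g

  lightWindow : ℕ → List ℕ → Bool
  lightWindow ℓ w = long ℓ ∧ light ℓ (take ℓ w)

  lightPrefix : List ℕ → Bool
  lightPrefix w = anyBelow (suc (length w)) (λ ℓ → lightWindow ℓ w)

  -- Some window of length ℓ with long ℓ is light.
  bad : List ℕ → Bool
  bad []      = lightPrefix []
  bad (d ∷ u) = lightPrefix (d ∷ u) ∨ bad u

  lightPrefix⇒bad : ∀ w → T (lightPrefix w) → T (bad w)
  lightPrefix⇒bad []      t = t
  lightPrefix⇒bad (d ∷ w) t = Equivalence.from T-∨ (inj₁ t)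

  bad-++ : ∀ xs w → T (bad w) → T (bad (xs ++ w))
  bad-++ []       w t = t
  bad-++ (x ∷ xs) w t = Equivalence.from T-∨ (inj₂ (bad-++ xs w t))

  ¬bad⇒Heavy : ∀ u → ¬ T (bad u) → ∀ v → IsSubstring v u → T (long (length v)) → Heavy v
  ¬bad⇒Heavy u ¬bad v (xs , ys , refl) long-v = ≰⇒> λ 3v≤αv → ¬bad (bad-++ xs (v ++ ys)
    (lightPrefix⇒bad (v ++ ys) (T-anyBelow (suc (length (v ++ ys))) _ |v|<1+|v++ys|
      (Equivalence.from T-∧ (long-v , subst (λ w → T (light (length v) w)) (sym (take-++ v ys)) (≤⇒≤ᵇ 3v≤αv))))))
    where
    |v|<1+|v++ys| : length v < suc (length (v ++ ys))
    |v|<1+|v++ys| = s≤s (subst (length v ≤_) (sym (length-++ v)) (m≤m+n (length v) (length ys)))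
    take-++ : ∀ (v ys : List ℕ) → take (length v) (v ++ ys) ≡ v
    take-++ []      ys = refl
    take-++ (x ∷ v) ys = cong (x ∷_) (take-++ v ys)

  windowCount : ℕ → ℕ
  windowCount ℓ = if long ℓ then count ℓ (light ℓ) else 0

  count-lightWindow : ∀ N ℓ → ℓ ≤ N → count N (lightWindow ℓ) ≡ windowCount ℓ * g ^ (N ∸ ℓ)
  count-lightWindow N ℓ ℓ≤N = begin
    count N (lightWindow ℓ)
      ≡⟨ count-∧ N (long ℓ) (λ w → light ℓ (take ℓ w)) ⟩
    (if long ℓ then count N (λ w → light ℓ (take ℓ w)) else 0)
      ≡⟨ cong (λ m → if long ℓ then count m (λ w → light ℓ (take ℓ w)) else 0) (sym (m+[n∸m]≡n ℓ≤N)) ⟩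
    (if long ℓ then count (ℓ + (N ∸ ℓ)) (λ w → light ℓ (take ℓ w)) else 0)
      ≡⟨ cong (λ c → if long ℓ then c else 0) (count-take ℓ (N ∸ ℓ) (light ℓ)) ⟩
    (if long ℓ then count ℓ (light ℓ) * g ^ (N ∸ ℓ) else 0)
      ≡⟨ if-* (long ℓ) ⟩
    windowCount ℓ * g ^ (N ∸ ℓ) ∎
    where
    open ≡-Reasoning
    if-* : ∀ b → (if b then count ℓ (light ℓ) * g ^ (N ∸ ℓ) else 0)
                 ≡ (if b then count ℓ (light ℓ) else 0) * g ^ (N ∸ ℓ)
    if-* true  = refl
    if-* false = refl

  lightCount : ℕ → ℕ
  lightCount N = ∑[ ℓ < suc N ] (windowCount ℓ * g ^ (N ∸ ℓ))

  count-lightPrefix : ∀ N → count N lightPrefix ≤ lightCount N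
  count-lightPrefix N = begin
    count N lightPrefix
      ≤⟨ count-mono N (λ w |w|≡N → subst (λ n → T (anyBelow (suc n) (λ ℓ → lightWindow ℓ w))) |w|≡N) ⟩
    count N (λ w → anyBelow (suc N) (λ ℓ → lightWindow ℓ w))
      ≤⟨ count-anyBelow N (suc N) lightWindow ⟩
    ∑[ ℓ < suc N ] count N (lightWindow ℓ)
      ≡⟨ sumBelow-cong (suc N) (λ ℓ ℓ<1+N → count-lightWindow N ℓ (≤-pred ℓ<1+N)) ⟩
    lightCount N ∎
    where open ≤-Reasoning

  g*lightCount≤ : ∀ N → g * lightCount N ≤ lightCount (suc N)
  g*lightCount≤ N = begin
    g * lightCount N
      ≡⟨ sym (sumBelow-*ˡ (suc N) g _) ⟩
    ∑[ ℓ < suc N ] (g * (windowCount ℓ * g ^ (N ∸ ℓ)))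
      ≡⟨ sumBelow-cong (suc N) (λ ℓ ℓ<1+N → trans (x∙yz≈y∙xz g (windowCount ℓ) _)
           (cong (λ k → windowCount ℓ * g ^ k) (sym (+-∸-assoc 1 (≤-pred ℓ<1+N))))) ⟩
    ∑[ ℓ < suc N ] (windowCount ℓ * g ^ (suc N ∸ ℓ))
      ≤⟨ m≤m+n _ _ ⟩
    lightCount (suc N) ∎
    where open ≤-Reasoning

  count-bad : ∀ N → count N bad ≤ suc N * lightCount N
  count-bad zero    = ≤-trans (count-lightPrefix zero) (≤-reflexive (sym (+-identityʳ _)))
  count-bad (suc N) = begin
    ∑[ d < g ] count N (λ w → lightPrefix (d ∷ w) ∨ bad w)
      ≤⟨ sumBelow-mono-≤ g (λ d _ → count-∨ N _ _) ⟩
    ∑[ d < g ] (count N (λ w → lightPrefix (d ∷ w)) + count N bad)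
      ≡⟨ sumBelow-distrib-+ g _ _ ⟩
    count (suc N) lightPrefix + ∑[ d < g ] count N bad
      ≡⟨ cong (count (suc N) lightPrefix +_) (sumBelow-const g _) ⟩
    count (suc N) lightPrefix + g * count N bad
      ≤⟨ +-mono-≤ (count-lightPrefix (suc N)) (*-monoʳ-≤ g (count-bad N)) ⟩
    lightCount (suc N) + g * (suc N * lightCount N)
      ≡⟨ cong (lightCount (suc N) +_) (x∙yz≈y∙xz g (suc N) _) ⟩
    lightCount (suc N) + suc N * (g * lightCount N)
      ≤⟨ +-monoʳ-≤ (lightCount (suc N)) (*-monoʳ-≤ (suc N) (g*lightCount≤ N)) ⟩
    suc (suc N) * lightCount (suc N) ∎
    where open ≤-Reasoning

  -- Each of the at most L starting points and each long length ℓ contribute at most a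
  -- (r/h)^ℓ / (2hL) fraction of all words, and Σ_ℓ (r/h)^ℓ ≤ h.
  module _ (L r : ℕ)
           (window-bound : ∀ ℓ → T (long ℓ) → 2 * suc r * L * count ℓ (light ℓ) * suc r ^ ℓ ≤ g ^ ℓ * r ^ ℓ) where
    h : ℕ
    h = suc r

    windowCount-bound : ∀ ℓ → 2 * h * L * windowCount ℓ * h ^ ℓ ≤ g ^ ℓ * r ^ ℓ
    windowCount-bound ℓ with long ℓ | window-bound ℓ
    ... | true  | bound = bound tt
    ... | false | _     = ≤-trans (≤-reflexive (cong (_* h ^ ℓ) (*-zeroʳ (2 * h * L)))) z≤n

    lightCount-term : ∀ N ℓ → ℓ ≤ N → suc N ≤ L →
      2 * suc N * (windowCount ℓ * g ^ (N ∸ ℓ)) * h ^ suc N ≤ g ^ N * (r ^ ℓ * h ^ (N ∸ ℓ))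
    lightCount-term N ℓ ℓ≤N 1+N≤L = begin
      2 * suc N * (windowCount ℓ * g ^ (N ∸ ℓ)) * (h * h ^ N)
        ≡⟨ cong (λ k → 2 * suc N * (windowCount ℓ * g ^ (N ∸ ℓ)) * (h * k)) (^-split h ℓ≤N) ⟩
      2 * suc N * (windowCount ℓ * g ^ (N ∸ ℓ)) * (h * (h ^ ℓ * h ^ (N ∸ ℓ)))
        ≡⟨ regroup (suc N) (windowCount ℓ) (g ^ (N ∸ ℓ)) h (h ^ ℓ) (h ^ (N ∸ ℓ)) ⟩
      2 * h * suc N * windowCount ℓ * h ^ ℓ * (g ^ (N ∸ ℓ) * h ^ (N ∸ ℓ))
        ≤⟨ *-monoˡ-≤ _ (*-monoˡ-≤ (h ^ ℓ) (*-monoˡ-≤ (windowCount ℓ) (*-monoʳ-≤ (2 * h) 1+N≤L))) ⟩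
      2 * h * L * windowCount ℓ * h ^ ℓ * (g ^ (N ∸ ℓ) * h ^ (N ∸ ℓ))
        ≤⟨ *-monoˡ-≤ _ (windowCount-bound ℓ) ⟩
      g ^ ℓ * r ^ ℓ * (g ^ (N ∸ ℓ) * h ^ (N ∸ ℓ))
        ≡⟨ interchange (g ^ ℓ) (r ^ ℓ) (g ^ (N ∸ ℓ)) (h ^ (N ∸ ℓ)) ⟩
      g ^ ℓ * g ^ (N ∸ ℓ) * (r ^ ℓ * h ^ (N ∸ ℓ))
        ≡⟨ cong (_* (r ^ ℓ * h ^ (N ∸ ℓ))) (sym (^-split g ℓ≤N)) ⟩
      g ^ N * (r ^ ℓ * h ^ (N ∸ ℓ)) ∎
      where
      open ≤-Reasoning
      regroup : ∀ n w G h H H′ → 2 * n * (w * G) * (h * (H * H′)) ≡ 2 * h * n * w * H * (G * H′)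
      regroup = solve-∀

    count-bad-half : ∀ N → suc N ≤ L → 2 * count N bad ≤ g ^ N
    count-bad-half N 1+N≤L = ≤-trans (*-monoʳ-≤ 2 (count-bad N))
      (*-cancelʳ-≤ _ _ (h ^ suc N) {{m^n≢0 h (suc N)}} (begin
        2 * (suc N * lightCount N) * h ^ suc N
          ≡⟨ cong (_* h ^ suc N) (sym (*-assoc 2 (suc N) (lightCount N))) ⟩
        2 * suc N * lightCount N * h ^ suc N
          ≡⟨ sym (trans (sumBelow-*ʳ (suc N) (h ^ suc N) _) (cong (_* h ^ suc N) (sumBelow-*ˡ (suc N) (2 * suc N) _))) ⟩
        ∑[ ℓ < suc N ] (2 * suc N * (windowCount ℓ * g ^ (N ∸ ℓ)) * h ^ suc N)
          ≤⟨ sumBelow-mono-≤ (suc N) (λ ℓ ℓ<1+N → lightCount-term N ℓ (≤-pred ℓ<1+N) 1+N≤L) ⟩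
        ∑[ ℓ < suc N ] (g ^ N * (r ^ ℓ * h ^ (N ∸ ℓ)))
          ≡⟨ sumBelow-*ˡ (suc N) (g ^ N) _ ⟩
        g ^ N * ∑[ ℓ < suc N ] (r ^ ℓ * h ^ (N ∸ ℓ))
          ≤⟨ *-monoʳ-≤ (g ^ N) (≤-trans (m≤m+n _ _) (≤-reflexive (sumBelow-geometric r (suc N)))) ⟩
        g ^ N * h ^ suc N ∎))
      where open ≤-Reasoning

-- The construction

image : (ℕ → Bool) → (ℕ → ℕ) → ℕ → List ℕ
image p f zero    = []
image p f (suc M) = if p M then f M ∷ image p f M else image p f M

module _ (p : ℕ → Bool) (f : ℕ → ℕ) where
  length-image : ∀ M → length (image p f M) ≡ ∑[ U < M ] boolToℕ (p U)
  length-image zero    = refl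
  length-image (suc M) with p M
  ... | true  = trans (cong suc (length-image M)) (+-comm 1 _)
  ... | false = trans (length-image M) (sym (+-identityʳ _))

  All-image : ∀ {P : ℕ → Set} M → (∀ U → U < M → T (p U) → P (f U)) → All P (image p f M)
  All-image zero    _    = []
  All-image (suc M) P-fU with p M | P-fU M ≤-refl
  ... | true  | P-fM = P-fM _ ∷ All-image M (λ U U<M → P-fU U (m<n⇒m<1+n U<M))
  ... | false | _    = All-image M (λ U U<M → P-fU U (m<n⇒m<1+n U<M))

  Unique-image : ∀ M → (∀ {U V} → U < M → V < M → f U ≡ f V → U ≡ V) → Unique (image p f M)
  Unique-image zero    _     = []
  Unique-image (suc M) f-inj with p M
  ... | true  = All-image M (λ U U<M _ fM≡fU → <-irrefl (sym (f-inj (n<1+n M) (m<n⇒m<1+n U<M) fM≡fU)) U<M)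
              ∷ Unique-image M (λ U<M V<M → f-inj (m<n⇒m<1+n U<M) (m<n⇒m<1+n V<M))
  ... | false = Unique-image M (λ U<M V<M → f-inj (m<n⇒m<1+n U<M) (m<n⇒m<1+n V<M))

between-powers : ∀ g → 1 < g → ∀ y → ∃[ L ] (g ^ L ≤ suc y × suc y < g ^ suc L)
between-powers g 1<g zero = 0 , ≤-refl , ≤-trans 1<g (≤-reflexive (sym (*-identityʳ g)))
between-powers g 1<g (suc y) with between-powers g 1<g y
... | L , g^L≤1+y , 1+y<g^[1+L] with suc (suc y) <? g ^ suc L
...   | yes 2+y<g^[1+L] = L , ≤-trans g^L≤1+y (n≤1+n _) , 2+y<g^[1+L]
...   | no  2+y≮g^[1+L] = suc L , ≮⇒≥ 2+y≮g^[1+L] , (begin-strict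
          suc (suc y)      ≤⟨ 1+y<g^[1+L] ⟩
          g ^ suc L        <⟨ m<m*n (g ^ suc L) g {{m^n≢0 g (suc L) {{>-nonZero (<⇒≤ 1<g)}}}} 1<g ⟩
          g ^ suc L * g    ≡⟨ *-comm (g ^ suc L) g ⟩
          g ^ suc (suc L)  ∎)
  where open ≤-Reasoning

++-cancelˡ-length : ∀ (a a′ : List ℕ) {x y} → length a ≡ length a′ → a ++ x ≡ a′ ++ y → x ≡ y
++-cancelˡ-length []      []       _   eq = eq
++-cancelˡ-length (_ ∷ a) (_ ∷ a′) len eq = ++-cancelˡ-length a a′ (suc-injective len) (proj₂ (∷-injective eq))

∣-%ℕ-complement : ∀ q .{{_ : NonZero q}} a S r → (ℤ.+ q) ℤ∣.∣ (ℤ.+ ((r ℤ.- ℤ.+ S) %ℕ q + q * a + S) ℤ.- r)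
∣-%ℕ-complement q a S r = ∣⇒∣ᵤ (divides (ℤ.+ a ℤ.- k) (begin
  ℤ.+ (j + q * a + S) ℤ.- r                  ≡⟨ cong (λ x → x ℤ.- r) cast ⟩
  ℤ.+ j ℤ.+ ℤ.+ q ℤ.* ℤ.+ a ℤ.+ ℤ.+ S ℤ.- r  ≡⟨ split (ℤ.+ j) (ℤ.+ q) (ℤ.+ a) (ℤ.+ S) r k ⟩
  (ℤ.+ j ℤ.+ k ℤ.* ℤ.+ q) ℤ.+ rest
    ≡⟨ cong (λ x → x ℤ.+ rest) (sym (a≡a%ℕn+[a/ℕn]*n (r ℤ.- ℤ.+ S) q)) ⟩
  (r ℤ.- ℤ.+ S) ℤ.+ rest                     ≡⟨ collect (ℤ.+ q) (ℤ.+ a) (ℤ.+ S) r k ⟩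
  (ℤ.+ a ℤ.- k) ℤ.* ℤ.+ q                    ∎))
  where
  open ≡-Reasoning
  j = (r ℤ.- ℤ.+ S) %ℕ q
  k = (r ℤ.- ℤ.+ S) /ℕ q
  rest = ℤ.+ q ℤ.* ℤ.+ a ℤ.+ ℤ.+ S ℤ.- r ℤ.- k ℤ.* ℤ.+ q
  cast : ℤ.+ (j + q * a + S) ≡ ℤ.+ j ℤ.+ ℤ.+ q ℤ.* ℤ.+ a ℤ.+ ℤ.+ S
  cast = trans (pos-+ (j + q * a) S)
    (cong (λ x → x ℤ.+ ℤ.+ S) (trans (pos-+ j (q * a)) (cong (λ x → ℤ.+ j ℤ.+ x) (pos-* q a))))
  split : ∀ j q a s r k → j ℤ.+ q ℤ.* a ℤ.+ s ℤ.- r ≡ (j ℤ.+ k ℤ.* q) ℤ.+ (q ℤ.* a ℤ.+ s ℤ.- r ℤ.- k ℤ.* q)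
  split = ℤ-Solver.solve-∀
  collect : ∀ q a s r k → (r ℤ.- s) ℤ.+ (q ℤ.* a ℤ.+ s ℤ.- r ℤ.- k ℤ.* q) ≡ (a ℤ.- k) ℤ.* q
  collect = ℤ-Solver.solve-∀

module Construction (b q : ℕ) .{{_ : NonZero q}} (r : ℤ) where
  open BaseExpansion b
  α : ℕ
  α = suc b
  open DigitWeight α

  -- The numbers built have digits prefix j ++ u ++ [α]: the prefix adjusts the digit sum
  -- mod q with all suffixes balanced, and the final digit α is nonzero.
  prefix : ℕ → List ℕ
  prefix j = interleave (replicate j 1 ++ replicate (q ∸ j) 0)

  length-ones-zeros : ∀ j → j ≤ q → length (replicate j 1 ++ replicate (q ∸ j) 0) ≡ q
  length-ones-zeros j j≤q = trans (length-++ (replicate j 1))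
    (trans (cong₂ _+_ (length-replicate j) (length-replicate (q ∸ j))) (m+[n∸m]≡n j≤q))

  sum-ones-zeros : ∀ j k → sum (replicate j 1 ++ replicate k 0) ≡ j
  sum-ones-zeros zero    zero    = refl
  sum-ones-zeros zero    (suc k) = sum-ones-zeros zero k
  sum-ones-zeros (suc j) k       = cong suc (sum-ones-zeros j k)

  length-prefix : ∀ j → j ≤ q → length (prefix j) ≡ q + q
  length-prefix j j≤q = trans (length-interleave (replicate j 1 ++ replicate (q ∸ j) 0))
    (cong₂ _+_ (length-ones-zeros j j≤q) (length-ones-zeros j j≤q))

  sum-prefix : ∀ j → j ≤ q → sum (prefix j) ≡ j + q * α
  sum-prefix j j≤q = trans (sum-interleave (replicate j 1 ++ replicate (q ∸ j) 0))
    (cong₂ (λ s n → s + n * α) (sum-ones-zeros j (q ∸ j)) (length-ones-zeros j j≤q))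

  prefix-digits : ∀ j → All (_< g) (prefix j)
  prefix-digits j = interleave-digits (++⁺ (replicate⁺ j (s≤s (s≤s z≤n))) (replicate⁺ (q ∸ j) (s≤s z≤n)))
    where
    interleave-digits : ∀ {xs} → All (_< g) xs → All (_< g) (interleave xs)
    interleave-digits []           = []
    interleave-digits (x<g ∷ xs<g) = x<g ∷ ≤-refl ∷ interleave-digits xs<g

  residue : List ℕ → ℕ
  residue u = (r ℤ.- ℤ.+ (sum u + α)) %ℕ q

  residue≤q : ∀ u → residue u ≤ q
  residue≤q u = <⇒≤ (n%ℕd<d (r ℤ.- ℤ.+ (sum u + α)) q)

  word : List ℕ → List ℕ
  word u = prefix (residue u) ++ u ++ α ∷ []

  c : ℕ
  c = q + q + 1

  length-word : ∀ u → length (word u) ≡ c + length u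
  length-word u = begin
    length (prefix (residue u) ++ u ++ α ∷ [])
      ≡⟨ length-++ (prefix (residue u)) ⟩
    length (prefix (residue u)) + length (u ++ α ∷ [])
      ≡⟨ cong₂ _+_ (length-prefix (residue u) (residue≤q u)) (length-++ u) ⟩
    q + q + (length u + 1)
      ≡⟨ regroup q (length u) ⟩
    c + length u ∎
    where
    open ≡-Reasoning
    regroup : ∀ q n → q + q + (n + 1) ≡ q + q + 1 + n
    regroup = solve-∀

  sum-word : ∀ u → sum (word u) ≡ residue u + q * α + (sum u + α)
  sum-word u = begin
    sum (prefix (residue u) ++ u ++ α ∷ [])          ≡⟨ sum-++ (prefix (residue u)) _ ⟩
    sum (prefix (residue u)) + sum (u ++ α ∷ [])     ≡⟨ cong₂ _+_ (sum-prefix (residue u) (residue≤q u))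
                                                          (trans (sum-++ u _) (cong (λ s → sum u + s) (+-identityʳ α))) ⟩
    residue u + q * α + (sum u + α)                  ∎
    where open ≡-Reasoning

  q∣sum-word : ∀ u → (ℤ.+ q) ℤ∣.∣ (ℤ.+ sum (word u) ℤ.- r)
  q∣sum-word u = subst (λ s → (ℤ.+ q) ℤ∣.∣ (ℤ.+ s ℤ.- r)) (sym (sum-word u)) (∣-%ℕ-complement q α (sum u + α) r)

  word-snoc : ∀ u → word u ≡ (prefix (residue u) ++ u) ++ α ∷ []
  word-snoc u = sym (++-assoc (prefix (residue u)) u (α ∷ []))

  word-digits : ∀ u → All (_< g) u → All (_< g) (word u)
  word-digits u u<g = ++⁺ (prefix-digits (residue u)) (++⁺ u<g (≤-refl ∷ []))

  digits-word : ∀ u → All (_< g) u → digits g (value (word u)) ≡ word u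
  digits-word u u<g = begin
    digits g (value (word u))                                  ≡⟨ cong (λ w → digits g (value w)) (word-snoc u) ⟩
    digits g (value ((prefix (residue u) ++ u) ++ α ∷ []))
      ≡⟨ digits-value _ (subst (All (_< g)) (word-snoc u) (word-digits u u<g)) (s≤s z≤n) ⟩
    (prefix (residue u) ++ u) ++ α ∷ []                        ≡⟨ sym (word-snoc u) ⟩
    word u                                                     ∎
    where open ≡-Reasoning

  value-word-pos : ∀ u → 0 < value (word u)
  value-word-pos u = subst (λ w → 0 < value w) (sym (word-snoc u)) (value-pos (prefix (residue u) ++ u) (s≤s z≤n))

  value-word-injective : ∀ {u u′} → All (_< g) u → All (_< g) u′ → value (word u) ≡ value (word u′) → u ≡ u′
  value-word-injective {u} {u′} u<g u′<g eq = ++-cancelʳ (α ∷ []) u u′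
    (++-cancelˡ-length (prefix (residue u)) (prefix (residue u′))
      (trans (length-prefix _ (residue≤q u)) (sym (length-prefix _ (residue≤q u′))))
      (begin
        word u                     ≡⟨ sym (digits-word u u<g) ⟩
        digits g (value (word u))  ≡⟨ cong (digits g) eq ⟩
        digits g (value (word u′)) ≡⟨ digits-word u′ u′<g ⟩
        word u′                    ∎))
    where open ≡-Reasoning

  -- A window of u of length ℓ can grow by at most c digits of padding inside the number.
  long : ℕ → ℕ → Bool
  long L ℓ = L ^ 36 * 15625 ^ (ℓ + c) ≤ᵇ 46656 ^ (ℓ + c)

  bad : ℕ → List ℕ → Bool
  bad L = BadWords.bad α (long L)

  word-InS : ∀ u → All (_< g) u → ¬ T (bad (c + length u) u) → InS g q r (value (word u))
  word-InS u u<g ¬bad = value-word-pos u , q∣digit-sum , digit-windows-Heavy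
    where
    L = c + length u
    n = value (word u)
    q∣digit-sum : (ℤ.+ q) ℤ∣.∣ (ℤ.+ s g n ℤ.- r)
    q∣digit-sum = subst (λ w → (ℤ.+ q) ℤ∣.∣ (ℤ.+ sum w ℤ.- r)) (sym (digits-word u u<g)) (q∣sum-word u)
    digit-windows-Heavy : ∀ m → 1 ≤ m → IsSubstring (digits g m) (digits g n) → LogLe (len g n) (len g m) →
                          (g ∸ 1) * len g m < 3 * s g m
    digit-windows-Heavy m _ m⊑n logLe =
      Heavy-padded (Long L) (Long-mono L) c (prefix (residue u)) u (α ∷ [])
        (interleave-suffix-Balanced _) [α]-prefix-Balanced
        (≤-reflexive (cong (_+ 1) (length-prefix _ (residue≤q u))))
        (λ v v⊑u long-v → BadWords.¬bad⇒Heavy α (long L) u ¬bad v v⊑u (≤⇒≤ᵇ long-v))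
        (digits g m) (subst (IsSubstring (digits g m)) (digits-word u u<g) m⊑n)
        (LogLe⇒Long L (len g m) (subst (λ k → LogLe k (len g m)) len-n logLe))
      where
      len-n : len g n ≡ L
      len-n = trans (cong length (digits-word u u<g)) (length-word u)

  -- Numeral last, see [1-1/n]^n-bound-step.
  L₀ : ℕ
  L₀ = 46656 ^ c * 400 ^ 6

  -- The Chernoff factor (24/25)^ℓ combined with 400 L ≤ (4975/4800)^ℓ = (25/24 · 199/200)^ℓ.
  window-bound : ∀ L → L₀ ≤ L → ∀ ℓ → T (long L ℓ) →
    2 * suc 199 * L * Words.count g ℓ (LowDigitSum.light α ℓ) * suc 199 ^ ℓ ≤ g ^ ℓ * 199 ^ ℓ
  window-bound L L₀≤L ℓ long-ℓ = *-cancelʳ-≤ _ _ (25 ^ ℓ) {{m^n≢0 25 ℓ}} (begin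
    2 * 200 * L * W * 200 ^ ℓ * 25 ^ ℓ
      ≡⟨ regroup₁ (2 * 200 * L) W (200 ^ ℓ) (25 ^ ℓ) ⟩
    2 * 200 * L * (W * 25 ^ ℓ) * 200 ^ ℓ
      ≤⟨ *-monoˡ-≤ (200 ^ ℓ) (*-monoʳ-≤ (2 * 200 * L) (LowDigitSum.count-light α (P-cube-bound α (s≤s z≤n)) ℓ)) ⟩
    2 * 200 * L * (24 ^ ℓ * g ^ ℓ) * 200 ^ ℓ
      ≡⟨ regroup₂ (2 * 200 * L) (24 ^ ℓ) (g ^ ℓ) (200 ^ ℓ) ⟩
    2 * 200 * L * (24 ^ ℓ * 200 ^ ℓ) * g ^ ℓ
      ≡⟨ cong (λ x → 2 * 200 * L * x * g ^ ℓ) (sym (^-distribʳ-* 24 200 ℓ)) ⟩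
    400 * L * 4800 ^ ℓ * g ^ ℓ
      ≤⟨ *-monoˡ-≤ (g ^ ℓ) (^-beats-linear 400 4800 4975 46656 15625 (s≤s z≤n) (s≤s z≤n) (≤ᵇ⇒≤ _ _ _)
                                           L ℓ c L₀≤L (≤ᵇ⇒≤ _ _ long-ℓ)) ⟩
    4975 ^ ℓ * g ^ ℓ
      ≡⟨ cong (_* g ^ ℓ) (^-distribʳ-* 199 25 ℓ) ⟩
    199 ^ ℓ * 25 ^ ℓ * g ^ ℓ
      ≡⟨ regroup₃ (199 ^ ℓ) (25 ^ ℓ) (g ^ ℓ) ⟩
    g ^ ℓ * 199 ^ ℓ * 25 ^ ℓ ∎)
    where
    open ≤-Reasoning
    W = Words.count g ℓ (LowDigitSum.light α ℓ)
    regroup₁ : ∀ a w h v → a * w * h * v ≡ a * (w * v) * h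
    regroup₁ = solve-∀
    regroup₂ : ∀ a u g h → a * (u * g) * h ≡ a * (u * h) * g
    regroup₂ = solve-∀
    regroup₃ : ∀ r v g → r * v * g ≡ g * r * v
    regroup₃ = solve-∀

  goodWord : ℕ → ℕ → Bool
  goodWord N U = not (bad (c + N) (padded N U))

  goodNumbers : ℕ → List ℕ
  goodNumbers N = image (goodWord N) (λ U → value (word (padded N U))) (g ^ N)

  Unique-goodNumbers : ∀ N → Unique (goodNumbers N)
  Unique-goodNumbers N = Unique-image _ _ (g ^ N) λ U< V< eq →
    padded-injective N U< V< (value-word-injective (padded-digits N _) (padded-digits N _) eq)

  All-goodNumbers : ∀ N → All (λ n → 1 ≤ n × n < g ^ (c + N) × InS g q r n) (goodNumbers N)
  All-goodNumbers N = All-image _ _ (g ^ N) λ U _ good → let u = padded N U in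
    value-word-pos u ,
    subst (λ k → value (word u) < g ^ k) (trans (length-word u) (cong (c +_) (length-padded N U)))
      (value-< (word u) (word-digits u (padded-digits N U))) ,
    word-InS u (padded-digits N U) (subst (λ k → ¬ T (bad (c + k) u)) (sym (length-padded N U)) (T-not⇒¬T good))
    where
    T-not⇒¬T : ∀ {b} → T (not b) → ¬ T b
    T-not⇒¬T {false} _ ()
    T-not⇒¬T {true}  ()

  length-goodNumbers : ∀ N → L₀ ≤ c + N → g ^ N ≤ 2 * length (goodNumbers N)
  length-goodNumbers N L₀≤L = subst (λ k → g ^ N ≤ 2 * k) (sym length≡G) (+-cancelʳ-≤ (g ^ N) _ _ (begin
    g ^ N + g ^ N             ≡⟨ cong₂ _+_ (sym (count-not N (bad L))) (sym (count-not N (bad L))) ⟩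
    G + B + (G + B)           ≡⟨ regroup G B ⟩
    2 * G + 2 * B             ≤⟨ +-monoʳ-≤ (2 * G) (count-bad-half L 199 (window-bound L L₀≤L) N N<L) ⟩
    2 * G + g ^ N             ∎))
    where
    open ≤-Reasoning
    open Words g using (count; count-not)
    open BadWords α (long (c + N)) using (count-bad-half)
    L = c + N
    G = count N (λ w → not (bad L w))
    B = count N (bad L)
    N<L : suc N ≤ L
    N<L = +-monoˡ-≤ N (m≤n+m 1 (q + q))
    length≡G : length (goodNumbers N) ≡ G
    length≡G = trans (length-image _ _ (g ^ N)) (sumBelow-padded N (λ w → not (bad L w)))
    regroup : ∀ G B → G + B + (G + B) ≡ 2 * G + 2 * B
    regroup = solve-∀

  goodNumbers-below : ∀ x → g ^ (L₀ + c) ≤ x →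
    ∃[ ns ] (Unique ns × All (λ n → 1 ≤ n × n ≤ x × InS g q r n) ns × x ≤ suc (2 * g ^ suc c) * length ns)
  goodNumbers-below zero    X≤0 = ⊥-elim (<⇒≱ (m^n>0 g (L₀ + c)) X≤0)
  goodNumbers-below (suc y) X≤x with between-powers g (s≤s (s≤s z≤n)) y
  ... | L , g^L≤x , x<g^[1+L] = goodNumbers N , Unique-goodNumbers N ,
        All.map (λ { (1≤n , n<g^[c+N] , n∈S) → 1≤n , ≤-trans (<⇒≤ n<g^[c+N]) g^[c+N]≤x , n∈S }) (All-goodNumbers N) ,
        (begin
          suc y                                        ≤⟨ <⇒≤ x<g^[1+L] ⟩
          g ^ suc L                                    ≡⟨ cong (λ k → g ^ suc k) (sym c+N≡L) ⟩
          g ^ (suc c + N)                              ≡⟨ ^-distribˡ-+-* g (suc c) N ⟩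
          g ^ suc c * g ^ N                            ≤⟨ *-monoʳ-≤ (g ^ suc c) (length-goodNumbers N L₀≤c+N) ⟩
          g ^ suc c * (2 * length (goodNumbers N))     ≡⟨ x∙yz≈yx∙z (g ^ suc c) 2 _ ⟩
          2 * g ^ suc c * length (goodNumbers N)       ≤⟨ *-monoˡ-≤ (length (goodNumbers N)) (n≤1+n (2 * g ^ suc c)) ⟩
          suc (2 * g ^ suc c) * length (goodNumbers N) ∎)
    where
    open ≤-Reasoning
    L₀+c≤L : L₀ + c ≤ L
    L₀+c≤L = ≮⇒≥ λ L<L₀+c → <⇒≱ x<g^[1+L] (≤-trans (^-monoʳ-≤ g L<L₀+c) X≤x)
    N = L ∸ c
    c+N≡L : c + N ≡ L
    c+N≡L = m+[n∸m]≡n (≤-trans (m≤n+m c L₀) L₀+c≤L)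
    L₀≤c+N : L₀ ≤ c + N
    L₀≤c+N = subst (L₀ ≤_) (sym c+N≡L) (≤-trans (m≤m+n L₀ c) L₀+c≤L)
    g^[c+N]≤x : g ^ (c + N) ≤ suc y
    g^[c+N]≤x = subst (λ k → g ^ k ≤ suc y) (sym c+N≡L) g^L≤x

  density : PositiveLowerDensity (InS g q r)
  density = 2 * g ^ suc c , g ^ (L₀ + c) , goodNumbers-below

lemma4 : (g q : ℕ) (r : ℤ) → 2 ≤ g → 1 ≤ q
    → PositiveLowerDensity (InS g q r)
lemma4 (suc (suc b)) q r (s≤s (s≤s z≤n)) 1≤q = Construction.density b q {{>-nonZero 1≤q}} r
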